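{- Let $G$ be a graph with no isolated vertices, with at most one vertex of degree $1$, and with $m$ edges. Then $\Delta(G)\leq \lfloor\frac{2m+1}{3}\rfloor$. Moreover, equality holds if and only if: if $m=3k$: $G\in \{K_{1}\vee kP_{2},\ K_{1}\vee ((k-2)P_{2}\cup S_{3}\cup P_{1})\}$; if $m=3k+1$: $G\cong K_{1}\vee (kP_{2}\cup P_{1})$; if $m=3k+2$: $G\in \{L_{1},\ L_{2},\ K_{1}\vee ((k-1)P_{2}\cup S_{3}),\ K_{1}\vee ((k-2)P_{2}\cup S_{4}\cup P_{1}),\ K_{1}\vee ((k-2)P_{2}\cup P_{4}\cup P_{1}),\ K_{1}\vee ((k-3)P_{2}\cup 2S_{3}\cup P_{1})\}$.
   Context: $\Delta(G)$ is the maximum degree. $P_n$ is the path on $n$ vertices, $S_n=K_{1,n-1}$ the star on $n$ vertices, $\cup$ denotes disjoint union, $kG$ the disjoint union of $k$ copies of $G$, $G\vee H$ the join. For $m=3k+2$: $L_{1}$ is the graph obtained from $K_{1}\vee((k-1)P_{2}\cup 3P_{1})$ by adding a new vertex $w'$ adjacent to exactly two of the three vertices of the $3P_1$ part; $L_{2}$ is the graph obtained from $K_{1}\vee(kP_{2}\cup P_{1})$ by adding a new vertex $w'$ adjacent only to the vertex of the $P_1$ part. (Both have $3k+2$ edges and maximum degree $2k+1$.) -}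

module Defs where

open import Data.Nat using (ℕ; zero; suc; _+_; _*_; _∸_; _⊔_; _≡ᵇ_; _≤ᵇ_)
open import Data.Bool using (Bool; true; false; _∨_; if_then_else_)
open import Data.Bool.Properties using (∨-comm)
open import Data.Fin using (Fin; zero; suc; toℕ; splitAt)
open import Data.Sum using (_⊎_; inj₁; inj₂)
open import Data.List using (List; allFin; map; foldr)
open import Data.Nat.ListAction using (sum)
open import Function.Bundles using (_↔_; Inverse)
open import Relation.Binary.PropositionalEquality using (_≡_; refl)

record Graph : Set where
  field
    order  : ℕ
    adj    : Fin order → Fin order → Bool
    sym    : ∀ i j → adj i j ≡ adj j i
    irrefl : ∀ i → adj i i ≡ false
open Graph public

deg : (G : Graph) → Fin (order G) → ℕ
deg G v = sum (map (λ u → if adj G v u then 1 else 0) (allFin (order G)))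

-- maximum degree Δ(G) (0 for the graph with no vertices)
maxDeg : Graph → ℕ
maxDeg G = foldr (λ v acc → deg G v ⊔ acc) 0 (allFin (order G))

edges : Graph → ℕ
edges G = sum (map (λ i → sum (map (λ j → if (suc (toℕ i) ≤ᵇ toℕ j) then (if adj G i j then 1 else 0) else 0)
                                   (allFin (order G))))
                   (allFin (order G)))

record _≅_ (G H : Graph) : Set where
  field
    bij  : Fin (order G) ↔ Fin (order H)
    pres : ∀ i j → adj H (Inverse.to bij i) (Inverse.to bij j) ≡ adj G i j

empty : ℕ → Graph
empty n = record { order = n ; adj = λ _ _ → false ; sym = λ _ _ → refl ; irrefl = λ _ → refl }

K₁ : Graph
K₁ = empty 1

module _ (G H : Graph) (cross : Bool) where
  private
    sumAdj : Fin (order G) ⊎ Fin (order H) → Fin (order G) ⊎ Fin (order H) → Bool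
    sumAdj (inj₁ a) (inj₁ b) = adj G a b
    sumAdj (inj₂ a) (inj₂ b) = adj H a b
    sumAdj (inj₁ _) (inj₂ _) = cross
    sumAdj (inj₂ _) (inj₁ _) = cross

    sumSym : ∀ x y → sumAdj x y ≡ sumAdj y x
    sumSym (inj₁ a) (inj₁ b) = sym G a b
    sumSym (inj₂ a) (inj₂ b) = sym H a b
    sumSym (inj₁ _) (inj₂ _) = refl
    sumSym (inj₂ _) (inj₁ _) = refl

    sumIrr : ∀ x → sumAdj x x ≡ false
    sumIrr (inj₁ a) = irrefl G a
    sumIrr (inj₂ a) = irrefl H a

  -- vertices of G come first (indices 0 … order G - 1), then those of H;
  -- vertices of G and H are adjacent iff cross = true
  combine : Graph
  combine = record
    { order  = order G + order H
    ; adj    = λ i j → sumAdj (splitAt (order G) i) (splitAt (order G) j)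
    ; sym    = λ i j → sumSym (splitAt (order G) i) (splitAt (order G) j)
    ; irrefl = λ i → sumIrr (splitAt (order G) i)
    }

_∪_ : Graph → Graph → Graph
G ∪ H = combine G H false

_∨G_ : Graph → Graph → Graph
G ∨G H = combine G H true

infixr 5 _∪_
infixr 4 _∨G_

copies : ℕ → Graph → Graph
copies zero    G = empty 0
copies (suc k) G = G ∪ copies k G

private
  suc≢ : ∀ x → (suc x ≡ᵇ x) ≡ false
  suc≢ zero    = refl
  suc≢ (suc x) = suc≢ x

  irrP : ∀ x → ((suc x ≡ᵇ x) ∨ (suc x ≡ᵇ x)) ≡ false
  irrP x rewrite suc≢ x = refl

path : ℕ → Graph
path n = record
  { order  = n
  ; adj    = λ i j → (suc (toℕ i) ≡ᵇ toℕ j) ∨ (suc (toℕ j) ≡ᵇ toℕ i)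
  ; sym    = λ i j → ∨-comm (suc (toℕ i) ≡ᵇ toℕ j) (suc (toℕ j) ≡ᵇ toℕ i)
  ; irrefl = λ i → irrP (toℕ i)
  }

P₂ P₄ : Graph
P₂ = path 2
P₄ = path 4

-- star S n = K_{1,n-1} (n ≥ 1)
star : ℕ → Graph
star n = K₁ ∨G empty (n ∸ 1)

S₃ S₄ : Graph
S₃ = star 3
S₄ = star 4

-- add a new vertex (index 0) adjacent exactly to the old vertices v with s v = true
-- (old vertex v becomes suc v)
addVertex : (G : Graph) → (Fin (order G) → Bool) → Graph
addVertex G s = record { order = suc (order G) ; adj = a ; sym = sy ; irrefl = ir }
  where
    a : Fin (suc (order G)) → Fin (suc (order G)) → Bool
    a zero    zero    = false
    a zero    (suc j) = s j
    a (suc i) zero    = s i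
    a (suc i) (suc j) = adj G i j
    sy : ∀ i j → a i j ≡ a j i
    sy zero    zero    = refl
    sy zero    (suc j) = refl
    sy (suc i) zero    = refl
    sy (suc i) (suc j) = sym G i j
    ir : ∀ i → a i i ≡ false
    ir zero    = refl
    ir (suc i) = irrefl G i

E₁ : ℕ → Graph
E₁ k = K₁ ∨G copies k P₂
E₂ : ℕ → Graph                       -- needs k ≥ 2
E₂ k = K₁ ∨G (copies (k ∸ 2) P₂ ∪ S₃ ∪ K₁)

F₁ : ℕ → Graph
F₁ k = K₁ ∨G (copies k P₂ ∪ K₁)

-- m = 3k+2
-- L₁ : base K₁ ∨ ((k-1)P₂ ∪ 3P₁) has vertices 0 (centre), 1 … 2k-2 (the P₂'s),
-- 2k-1, 2k, 2k+1 (the 3P₁); w' is joined to 2k and 2k+1.   (needs k ≥ 1)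
L₁ : ℕ → Graph
L₁ k = addVertex (K₁ ∨G (copies (k ∸ 1) P₂ ∪ empty 3)) (λ v → (2 * k) ≤ᵇ toℕ v)
-- L₂ : base K₁ ∨ (kP₂ ∪ P₁) has its P₁ vertex at index 2k+1; w' is joined to it only.
L₂ : ℕ → Graph
L₂ k = addVertex (K₁ ∨G (copies k P₂ ∪ K₁)) (λ v → suc (2 * k) ≡ᵇ toℕ v)
H₃ : ℕ → Graph                       -- needs k ≥ 1
H₃ k = K₁ ∨G (copies (k ∸ 1) P₂ ∪ S₃)
H₄ : ℕ → Graph                       -- needs k ≥ 2
H₄ k = K₁ ∨G (copies (k ∸ 2) P₂ ∪ S₄ ∪ K₁)
H₅ : ℕ → Graph                       -- needs k ≥ 2
H₅ k = K₁ ∨G (copies (k ∸ 2) P₂ ∪ P₄ ∪ K₁)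
H₆ : ℕ → Graph                       -- needs k ≥ 3
H₆ k = K₁ ∨G (copies (k ∸ 3) P₂ ∪ copies 2 S₃ ∪ K₁)

module Submission where

-- Let c be a vertex of maximum degree Δ and m the number of edges.  Give every vertex v the charge
-- deg v + [deg v = 1], which is at least 2 because there are no isolated vertices; the charges sum to
-- 2m + ℓ, where ℓ ≤ 1 is the number of leaves.  Assigning weight Δ to c and weight 2 to each neighbour
-- of c uses up 3Δ of it, and each vertex keeps a nonnegative defect, so 2m + ℓ = 3Δ + (total defect)
-- and 3Δ ≤ 2m + 1.  If Δ = ⌊(2m+1)/3⌋, the total defect is pinned down to at most 2; reading off the
-- few possible defect patterns, deleting c (and its non-neighbour, if there is one) leaves isolated
-- vertices, at most two small stars or a P₄, and a perfect matching; this is one of the listed graphs.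

open import Defs renaming (sym to adj-sym)
open import Data.Nat using (ℕ; suc; _+_; _*_; _/_; _≤_)
open import Data.Fin using (Fin)
open import Data.Product using (_×_)
open import Data.Sum using (_⊎_)
open import Function.Bundles using (_⇔_)
open import Relation.Nullary using (¬_)
open import Relation.Binary.PropositionalEquality using (_≡_)

open import Data.Nat.Properties
open import Algebra.Properties.CommutativeMonoid.Sum +-0-commutativeMonoid
  using (sum; sum-cong-≗; sum-remove; ∑-distrib-+; ∑-comm; ∑-permute)
open import Algebra.Properties.Semiring.Sum +-*-semiring using (*-distribˡ-sum)
open import Data.Bool using (Bool; true; false; if_then_else_)
import Data.Bool.Properties as Bool
open import Data.Empty using (⊥-elim)
open import Data.Fin using (toℕ; zero; suc; punchIn; punchOut; splitAt; join; _↑ˡ_; _↑ʳ_)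
import Data.Fin as Fin
open import Data.Fin.Patterns using (0F; 1F; 2F; 3F; 4F; 5F; 6F)
open import Data.Fin.Permutation using (permutation; _⟨$⟩ʳ_; _⟨$⟩ˡ_; inverseˡ; inverseʳ)
open import Data.Fin.Properties
  using (any?; injective⇒≤; punchInᵢ≢i; punchIn-injective; punchIn-punchOut; punchOut-cong; punchOut-injective; punchOut-punchIn;
         splitAt-↑ˡ; splitAt-↑ʳ; splitAt-join; join-splitAt; ↑ʳ-injective)
import Data.Fin.Properties as Fin
import Data.List as List hiding (sum)
import Data.List.Properties as List
import Data.Nat.ListAction as List
open import Data.Nat using (zero; z≤n; s≤s; _<_; _∸_; _⊔_; _≤ᵇ_; _≡ᵇ_)
open import Data.Nat.DivMod using (+-distrib-/-∣ʳ; m<n⇒m/n≡0; m*n/n≡m; /-monoˡ-≤)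
open import Data.Nat.Divisibility using (divides-refl)
open import Data.Nat.Tactic.RingSolver using (solve-∀)
open import Data.Product using (Σ; _,_; proj₁; proj₂; ∃)
import Data.Product
open import Data.Sum using (inj₁; inj₂)
import Data.Sum as Sum
import Data.Sum.Properties as Sum
open import Data.Vec.Functional using ([]; _∷_; _++_)
open import Function using (_∘_; id; case_of_)
open import Function.Bundles using (Equivalence; mk⇔)
open import Function.Definitions using (Injective)
open import Relation.Binary.Definitions using (tri<; tri≈; tri>)
open import Relation.Binary.PropositionalEquality using (_≢_; refl; sym; trans; cong; cong₂; subst; subst₂; module ≡-Reasoning)
open import Relation.Nullary using (Dec; yes; no; does; ¬?; _×-dec_)

bit : Bool → ℕ
bit b = if b then 1 else 0

bit≤1 : ∀ b → bit b ≤ 1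
bit≤1 true  = ≤-refl
bit≤1 false = z≤n

sum-zero : ∀ {n} {f : Fin n → ℕ} → (∀ i → f i ≡ 0) → sum f ≡ 0
sum-zero {zero}  f≡0 = refl
sum-zero {suc n} f≡0 = cong₂ _+_ (f≡0 zero) (sum-zero (f≡0 ∘ suc))

sum-ones : ∀ {n} {f : Fin n → ℕ} → (∀ i → f i ≡ 1) → sum f ≡ n
sum-ones {zero}  f≡1 = refl
sum-ones {suc n} f≡1 = cong₂ _+_ (f≡1 zero) (sum-ones (f≡1 ∘ suc))

sum-zero-inv : ∀ {n} (f : Fin n → ℕ) → sum f ≡ 0 → ∀ i → f i ≡ 0
sum-zero-inv f Σ≡0 zero    = m+n≡0⇒m≡0 (f zero) Σ≡0
sum-zero-inv f Σ≡0 (suc i) = sum-zero-inv (f ∘ suc) (m+n≡0⇒n≡0 (f zero) Σ≡0) i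

sum-↑ : ∀ m {n} (f : Fin (m + n) → ℕ) → sum f ≡ sum (f ∘ (_↑ˡ n)) + sum (f ∘ (m ↑ʳ_))
sum-↑ zero    f = refl
sum-↑ (suc m) f = trans (cong (f zero +_) (sum-↑ m (f ∘ suc))) (sym (+-assoc (f zero) _ _))

sum-single : ∀ {n} (f : Fin n → ℕ) (i : Fin n) → (∀ j → j ≢ i → f j ≡ 0) → sum f ≡ f i
sum-single {suc n} f i others≡0 = begin
  sum f                           ≡⟨ sum-remove f ⟩
  f i + sum (f ∘ punchIn i)       ≡⟨ cong (f i +_) (sum-zero (λ j → others≡0 _ (punchInᵢ≢i i j))) ⟩
  f i + 0                         ≡⟨ +-identityʳ (f i) ⟩
  f i                             ∎
  where open ≡-Reasoning

sum-∘-injective : ∀ {k n} (f : Fin n → ℕ) (e : Fin k → Fin n) → Injective _≡_ _≡_ e → sum (f ∘ e) ≤ sum f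
sum-∘-injective {zero}          f e e-inj = z≤n
sum-∘-injective {suc k} {zero}  f e e-inj with e zero
... | ()
sum-∘-injective {suc k} {suc n} f e e-inj = begin
  f a + sum (f ∘ e ∘ suc)               ≡⟨ cong (f a +_) (sum-cong-≗ (λ b → cong f (sym (punchIn-punchOut (a≢ b))))) ⟩
  f a + sum (f ∘ punchIn a ∘ e′)         ≤⟨ +-monoʳ-≤ (f a) (sum-∘-injective (f ∘ punchIn a) e′ e′-inj) ⟩
  f a + sum (f ∘ punchIn a)              ≡⟨ sum-remove f ⟨
  sum f                                  ∎
  where
  open ≤-Reasoning
  a : Fin (suc n)
  a = e zero
  a≢ : ∀ b → a ≢ e (suc b)
  a≢ b eq with e-inj eq
  ... | ()
  e′ : Fin k → Fin n
  e′ b = punchOut (a≢ b)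
  e′-inj : Injective _≡_ _≡_ e′
  e′-inj eq = Fin.suc-injective (e-inj (punchOut-injective (a≢ _) (a≢ _) eq))

≤1∧≢1⇒≡0 : ∀ {n} → n ≤ 1 → n ≢ 1 → n ≡ 0
≤1∧≢1⇒≡0 z≤n       _   = refl
≤1∧≢1⇒≡0 (s≤s z≤n) n≢1 = ⊥-elim (n≢1 refl)

sum≤1 : ∀ {n} (f : Fin n → ℕ) → (∀ i → f i ≤ 1) → (∀ i j → f i ≡ 1 → f j ≡ 1 → i ≡ j) → sum f ≤ 1
sum≤1 f f≤1 unique with any? (λ i → f i ≟ 1)
... | yes (i , fi≡1) = ≤-trans (≤-reflexive (sum-single f i others≡0)) (f≤1 i)
  where
  others≡0 : ∀ j → j ≢ i → f j ≡ 0
  others≡0 j j≢i = ≤1∧≢1⇒≡0 (f≤1 j) (λ fj≡1 → j≢i (unique j i fj≡1 fi≡1))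
... | no ¬one = ≤-trans (≤-reflexive (sum-zero (λ j → ≤1∧≢1⇒≡0 (f≤1 j) (λ fj≡1 → ¬one (j , fj≡1))))) z≤n

sum-positive : ∀ {n} (f : Fin n → ℕ) → 1 ≤ sum f → ∃ λ i → 1 ≤ f i
sum-positive f 1≤Σ with any? (λ i → 1 ≤? f i)
... | yes found = found
... | no ¬found with ≤-trans 1≤Σ (≤-reflexive (sum-zero (λ i → n≤0⇒n≡0 (≮⇒≥ (λ lt → ¬found (i , lt))))))
... | ()

sum≡1-inv : ∀ {n} (f : Fin n → ℕ) → sum f ≡ 1 → ∃ λ x → f x ≡ 1 × (∀ v → v ≢ x → f v ≡ 0)
sum≡1-inv {suc n} f Σ≡1 with sum-positive f (≤-reflexive (sym Σ≡1))
... | x , 1≤fx = x , fx≡1 , rest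
  where
  split : f x + sum (f ∘ punchIn x) ≡ 1
  split = trans (sym (sum-remove {i = x} f)) Σ≡1
  fx≡1 : f x ≡ 1
  fx≡1 = ≤-antisym (≤-trans (m≤m+n (f x) _) (≤-reflexive split)) 1≤fx
  rest : ∀ v → v ≢ x → f v ≡ 0
  rest v v≢x = trans (cong f (sym (punchIn-punchOut (v≢x ∘ sym))))
    (sum-zero-inv (f ∘ punchIn x) (+-cancelˡ-≡ 1 (sum (f ∘ punchIn x)) 0 (trans (cong (_+ sum (f ∘ punchIn x)) (sym fx≡1)) split)) _)

sum≡2-inv : ∀ {n} (f : Fin n → ℕ) → sum f ≡ 2 →
  (∃ λ x → f x ≡ 2 × (∀ v → v ≢ x → f v ≡ 0)) ⊎
  (∃ λ x → ∃ λ y → x ≢ y × f x ≡ 1 × f y ≡ 1 × (∀ v → v ≢ x → v ≢ y → f v ≡ 0))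
sum≡2-inv {suc n} f Σ≡2 with sum-positive f (≤-trans (s≤s z≤n) (≤-reflexive (sym Σ≡2)))
... | x , 1≤fx with f x in fx≡ | trans (sym (sum-remove {i = x} f)) Σ≡2
... | 0 | _ = ⊥-elim (<⇒≱ 1≤fx z≤n)
... | 1 | split with sum≡1-inv (f ∘ punchIn x) (+-cancelˡ-≡ 1 _ 1 split)
...   | y′ , fy≡1 , rest′ = inj₂ (x , punchIn x y′ , (λ eq → punchInᵢ≢i x y′ (sym eq)) , fx≡ , fy≡1 , rest)
  where
  rest : ∀ v → v ≢ x → v ≢ punchIn x y′ → f v ≡ 0
  rest v v≢x v≢y = trans (cong f (sym (punchIn-punchOut (v≢x ∘ sym))))
    (rest′ _ (λ eq → v≢y (trans (sym (punchIn-punchOut (v≢x ∘ sym))) (cong (punchIn x) eq))))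
sum≡2-inv {suc n} f Σ≡2 | x , _ | 2 | split = inj₁ (x , fx≡ , rest)
  where
  rest : ∀ v → v ≢ x → f v ≡ 0
  rest v v≢x = trans (cong f (sym (punchIn-punchOut (v≢x ∘ sym))))
    (sum-zero-inv (f ∘ punchIn x) (+-cancelˡ-≡ 2 _ 0 split) _)
sum≡2-inv {suc n} f Σ≡2 | x , _ | suc (suc (suc _)) | split with suc-injective (suc-injective split)
... | ()

sum-mono-≤ : ∀ {n} {f g : Fin n → ℕ} → (∀ i → f i ≤ g i) → sum f ≤ sum g
sum-mono-≤ {zero}  f≤g = z≤n
sum-mono-≤ {suc n} f≤g = +-mono-≤ (f≤g zero) (sum-mono-≤ (f≤g ∘ suc))

≤-sum : ∀ {n} (f : Fin n → ℕ) (i : Fin n) → f i ≤ sum f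
≤-sum {suc n} f i = ≤-trans (m≤m+n (f i) _) (≤-reflexive (sym (sum-remove f)))

δ : ∀ {n} → Fin n → Fin n → ℕ
δ u v = bit (does (u Fin.≟ v))

δ-refl : ∀ {n} (v : Fin n) → δ v v ≡ 1
δ-refl v with v Fin.≟ v
... | yes _  = refl
... | no v≢v = ⊥-elim (v≢v refl)

δ-≢ : ∀ {n} {u v : Fin n} → u ≢ v → δ u v ≡ 0
δ-≢ {u = u} {v} u≢v with u Fin.≟ v
... | yes u≡v = ⊥-elim (u≢v u≡v)
... | no _    = refl

sum-δ : ∀ {n} (v : Fin n) → sum (λ u → δ u v) ≡ 1
sum-δ v = trans (sum-single (λ u → δ u v) v (λ u → δ-≢)) (δ-refl v)

sum-≤-image : ∀ {k n} (f : Fin n → ℕ) (e : Fin k → Fin n) →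
  (∀ u → f u ≤ 1) → (∀ u → 1 ≤ f u → ∃ λ b → u ≡ e b) → sum f ≤ k
sum-≤-image {k} f e f≤1 supp = begin
  sum f                                       ≤⟨ sum-mono-≤ f≤δ ⟩
  sum (λ u → sum (λ b → δ u (e b)))           ≡⟨ ∑-comm (λ u b → δ u (e b)) ⟩
  sum (λ b → sum (λ u → δ u (e b)))           ≡⟨ sum-ones (λ b → sum-δ (e b)) ⟩
  k                                           ∎
  where
  open ≤-Reasoning
  f≤δ : ∀ u → f u ≤ sum (λ b → δ u (e b))
  f≤δ u with f u in fu≡ | f≤1 u
  ... | 0 | _ = z≤n
  ... | 1 | _ with supp u (≤-reflexive (sym fu≡))
  ...   | b , refl = ≤-trans (≤-reflexive (sym (δ-refl (e b)))) (≤-sum (λ b′ → δ (e b) (e b′)) b)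
  f≤δ u | suc (suc _) | s≤s ()

listSum-allFin : ∀ {n} (f : Fin n → ℕ) → List.sum (List.map f (List.allFin n)) ≡ sum f
listSum-allFin f = trans (cong List.sum (List.map-tabulate id f)) (tabulate-sum f)
  where
  tabulate-sum : ∀ {n} (f : Fin n → ℕ) → List.sum (List.tabulate f) ≡ sum f
  tabulate-sum {zero}  f = refl
  tabulate-sum {suc n} f = cong (f zero +_) (tabulate-sum (f ∘ suc))

deg-sum : (G : Graph) (v : Fin (order G)) → deg G v ≡ sum (λ u → bit (adj G v u))
deg-sum G v = listSum-allFin (λ u → bit (adj G v u))

adj⇒≢ : (G : Graph) {v w : Fin (order G)} → adj G v w ≡ true → v ≢ w
adj⇒≢ G {v} v~w refl with trans (sym v~w) (irrefl G v)
... | ()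

adj-symᵗ : (G : Graph) {v w : Fin (order G)} → adj G v w ≡ true → adj G w v ≡ true
adj-symᵗ G {v} {w} v~w = trans (adj-sym G w v) v~w

module _ {A : Set} where

  []-injective : Injective _≡_ _≡_ ([] {A = A})
  []-injective {()}

  ∷-injective : ∀ {k} {x : A} {e : Fin k → A} → (∀ b → x ≢ e b) → Injective _≡_ _≡_ e → Injective _≡_ _≡_ (x ∷ e)
  ∷-injective x∉e e-inj {zero}  {zero}  _  = refl
  ∷-injective x∉e e-inj {zero}  {suc b} eq = ⊥-elim (x∉e b eq)
  ∷-injective x∉e e-inj {suc a} {zero}  eq = ⊥-elim (x∉e a (sym eq))
  ∷-injective x∉e e-inj {suc a} {suc b} eq = cong suc (e-inj eq)

record Neighbours (G : Graph) (v : Fin (order G)) (k : ℕ) : Set where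
  field
    nbr           : Fin k → Fin (order G)
    nbr-injective : Injective _≡_ _≡_ nbr
    nbr-adjacent  : ∀ b → adj G v (nbr b) ≡ true

module _ (G : Graph) where

  Neighbours⇒≤deg : ∀ {v k} → Neighbours G v k → k ≤ deg G v
  Neighbours⇒≤deg {v} {k} N = begin
    k                                    ≡⟨ sum-ones (λ b → cong bit (nbr-adjacent b)) ⟨
    sum (λ b → bit (adj G v (nbr b)))    ≤⟨ sum-∘-injective (λ u → bit (adj G v u)) nbr nbr-injective ⟩
    sum (λ u → bit (adj G v u))          ≡⟨ deg-sum G v ⟨
    deg G v                              ∎
    where
    open ≤-Reasoning
    open Neighbours N

  extend : ∀ {v w k} (N : Neighbours G v k) → adj G v w ≡ true → (∀ b → w ≢ Neighbours.nbr N b) → Neighbours G v (suc k)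
  extend {w = w} N v~w w∉N = record
    { nbr           = w ∷ nbr
    ; nbr-injective = ∷-injective w∉N nbr-injective
    ; nbr-adjacent  = λ { zero → v~w ; (suc b) → nbr-adjacent b } }
    where open Neighbours N

  neighbour-listed : ∀ {v w k} → deg G v ≡ k → (N : Neighbours G v k) → adj G v w ≡ true →
    ∃ λ b → w ≡ Neighbours.nbr N b
  neighbour-listed {w = w} {k} deg≡k N v~w with any? (λ b → w Fin.≟ Neighbours.nbr N b)
  ... | yes found = found
  ... | no w∉N = ⊥-elim (<⇒≱ ≤-refl (subst (suc k ≤_) deg≡k (Neighbours⇒≤deg (extend N v~w (λ b w≡ → w∉N (b , w≡))))))

  -- Opaque, like splitting and V⁻¹ below: only their stated properties are used, and letting the
  -- type checker unfold these constructions makes checking the later case analyses blow up.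
  opaque
    neighbours : ∀ {v} k → k ≤ deg G v → Neighbours G v k
    neighbours zero    _ = record { nbr = [] ; nbr-injective = []-injective ; nbr-adjacent = λ () }
    neighbours {v} (suc k) k<deg
      with N ← neighbours k (≤-trans (n≤1+n k) k<deg)
      with any? (λ w → (adj G v w Bool.≟ true) ×-dec (¬? (any? (λ b → w Fin.≟ Neighbours.nbr N b))))
    ... | yes (w , v~w , w∉N) = extend N v~w (λ b w≡ → w∉N (b , w≡))
    ... | no ¬new = ⊥-elim (<⇒≱ k<deg (≤-trans (≤-reflexive (deg-sum G v)) (sum-≤-image _ nbr (λ u → bit≤1 (adj G v u)) listed)))
      where
      open Neighbours N
      listed : ∀ u → 1 ≤ bit (adj G v u) → ∃ λ b → u ≡ nbr b
      listed u _ with adj G v u in v~u | any? (λ b → u Fin.≟ nbr b)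
      ... | true | yes found = found
      ... | true | no  u∉N  = ⊥-elim (¬new (u , v~u , u∉N))

module _ {G H : Graph} (φ : G ≅ H) where

  to : Fin (order G) → Fin (order H)
  to = _≅_.bij φ ⟨$⟩ʳ_

  from : Fin (order H) → Fin (order G)
  from = _≅_.bij φ ⟨$⟩ˡ_

  to-from : ∀ y → to (from y) ≡ y
  to-from y = inverseʳ (_≅_.bij φ)

  from-to : ∀ x → from (to x) ≡ x
  from-to x = inverseˡ (_≅_.bij φ)

  to-adj : ∀ i j → adj H (to i) (to j) ≡ adj G i j
  to-adj = _≅_.pres φ

  to-injective : Injective _≡_ _≡_ to
  to-injective {x} {x′} eq = trans (sym (from-to x)) (trans (cong from eq) (from-to x′))

  from-injective : Injective _≡_ _≡_ from
  from-injective {y} {y′} eq = trans (sym (to-from y)) (trans (cong to eq) (to-from y′))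

  deg-to : ∀ i → deg H (to i) ≡ deg G i
  deg-to i = begin
    deg H (to i)                            ≡⟨ deg-sum H (to i) ⟩
    sum (λ u → bit (adj H (to i) u))        ≡⟨ ∑-permute (λ u → bit (adj H (to i) u)) (_≅_.bij φ) ⟩
    sum (λ x → bit (adj H (to i) (to x)))   ≡⟨ sum-cong-≗ (λ x → cong bit (to-adj i x)) ⟩
    sum (λ x → bit (adj G i x))             ≡⟨ deg-sum G i ⟨
    deg G i                                 ∎
    where open ≡-Reasoning

mk≅ : ∀ {G H} (f : Fin (order G) → Fin (order H)) (g : Fin (order H) → Fin (order G)) →
  (∀ y → f (g y) ≡ y) → (∀ x → g (f x) ≡ x) → (∀ i j → adj H (f i) (f j) ≡ adj G i j) → G ≅ H
mk≅ f g fg gf f-adj = record { bij = permutation f g fg gf ; pres = f-adj }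

≅-refl : ∀ {G} → G ≅ G
≅-refl = mk≅ id id (λ _ → refl) (λ _ → refl) (λ _ _ → refl)

≅-sym : ∀ {G H} → G ≅ H → H ≅ G
≅-sym {G} {H} φ = mk≅ (from φ) (to φ) (from-to φ) (to-from φ)
  (λ i j → trans (sym (to-adj φ (from φ i) (from φ j))) (cong₂ (adj H) (to-from φ i) (to-from φ j)))

infixr 9 _⨾_

_⨾_ : ∀ {G H K} → G ≅ H → H ≅ K → G ≅ K
φ ⨾ ψ = mk≅ (to ψ ∘ to φ) (from φ ∘ from ψ)
  (λ y → trans (cong (to ψ) (to-from φ (from ψ y))) (to-from ψ y))
  (λ x → trans (cong (from φ) (from-to ψ (to φ x))) (from-to φ x))
  (λ i j → trans (to-adj ψ (to φ i) (to φ j)) (to-adj φ i j))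

deg-from : ∀ {G H} (φ : G ≅ H) y → deg G (from φ y) ≡ deg H y
deg-from φ = deg-to (≅-sym φ)

graph : ∀ {n} (a : Fin n → Fin n → Bool) → (∀ i j → a i j ≡ a j i) → (∀ i → a i i ≡ false) → Graph
graph {n} a a-sym a-irr = record { order = n ; adj = a ; sym = a-sym ; irrefl = a-irr }

≅-adj-cong : (G : Graph) (a : Fin (order G) → Fin (order G) → Bool) (a-sym : ∀ i j → a i j ≡ a j i) (a-irr : ∀ i → a i i ≡ false) →
  (∀ i j → a i j ≡ adj G i j) → G ≅ graph a a-sym a-irr
≅-adj-cong G a a-sym a-irr a≗adj = mk≅ id id (λ _ → refl) (λ _ → refl) a≗adj

adj⊎ : (G H : Graph) → Bool → Fin (order G) ⊎ Fin (order H) → Fin (order G) ⊎ Fin (order H) → Bool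
adj⊎ G H b (inj₁ x) (inj₁ y) = adj G x y
adj⊎ G H b (inj₂ x) (inj₂ y) = adj H x y
adj⊎ G H b (inj₁ _) (inj₂ _) = b
adj⊎ G H b (inj₂ _) (inj₁ _) = b

sum-bit-const : ∀ n b → sum {n} (λ _ → bit b) ≡ (if b then n else 0)
sum-bit-const n true  = sum-ones {n} {λ _ → 1} (λ _ → refl)
sum-bit-const n false = sum-zero {n} {λ _ → 0} (λ _ → refl)

module _ (G H : Graph) (b : Bool) where

  adj-combine : ∀ i j → adj (combine G H b) i j ≡ adj⊎ G H b (splitAt (order G) i) (splitAt (order G) j)
  adj-combine i j with splitAt (order G) i | splitAt (order G) j
  ... | inj₁ _ | inj₁ _ = refl
  ... | inj₁ _ | inj₂ _ = refl
  ... | inj₂ _ | inj₁ _ = refl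
  ... | inj₂ _ | inj₂ _ = refl

  adj-combine-ˡˡ : ∀ x y → adj (combine G H b) (x ↑ˡ order H) (y ↑ˡ order H) ≡ adj G x y
  adj-combine-ˡˡ x y rewrite splitAt-↑ˡ (order G) x (order H) | splitAt-↑ˡ (order G) y (order H) = refl

  adj-combine-ʳʳ : ∀ x y → adj (combine G H b) (order G ↑ʳ x) (order G ↑ʳ y) ≡ adj H x y
  adj-combine-ʳʳ x y rewrite splitAt-↑ʳ (order G) (order H) x | splitAt-↑ʳ (order G) (order H) y = refl

  adj-combine-ˡʳ : ∀ x y → adj (combine G H b) (x ↑ˡ order H) (order G ↑ʳ y) ≡ b
  adj-combine-ˡʳ x y rewrite splitAt-↑ˡ (order G) x (order H) | splitAt-↑ʳ (order G) (order H) y = refl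

  adj-combine-ʳˡ : ∀ x y → adj (combine G H b) (order G ↑ʳ x) (y ↑ˡ order H) ≡ b
  adj-combine-ʳˡ x y rewrite splitAt-↑ʳ (order G) (order H) x | splitAt-↑ˡ (order G) y (order H) = refl

  deg-combine-ˡ : ∀ x → deg (combine G H b) (x ↑ˡ order H) ≡ deg G x + (if b then order H else 0)
  deg-combine-ˡ x = begin
    deg (combine G H b) (x ↑ˡ order H)                                  ≡⟨ deg-sum (combine G H b) _ ⟩
    sum (λ u → bit (adj (combine G H b) (x ↑ˡ order H) u))              ≡⟨ sum-↑ (order G) _ ⟩
    sum (λ u → bit (adj (combine G H b) (x ↑ˡ order H) (u ↑ˡ order H)))
      + sum (λ u → bit (adj (combine G H b) (x ↑ˡ order H) (order G ↑ʳ u)))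
      ≡⟨ cong₂ _+_ (trans (sum-cong-≗ (λ u → cong bit (adj-combine-ˡˡ x u))) (sym (deg-sum G x)))
                   (trans (sum-cong-≗ (λ u → cong bit (adj-combine-ˡʳ x u))) (sum-bit-const (order H) b)) ⟩
    deg G x + (if b then order H else 0)                                ∎
    where open ≡-Reasoning

  deg-combine-ʳ : ∀ x → deg (combine G H b) (order G ↑ʳ x) ≡ (if b then order G else 0) + deg H x
  deg-combine-ʳ x = begin
    deg (combine G H b) (order G ↑ʳ x)                                  ≡⟨ deg-sum (combine G H b) _ ⟩
    sum (λ u → bit (adj (combine G H b) (order G ↑ʳ x) u))              ≡⟨ sum-↑ (order G) _ ⟩
    sum (λ u → bit (adj (combine G H b) (order G ↑ʳ x) (u ↑ˡ order H)))
      + sum (λ u → bit (adj (combine G H b) (order G ↑ʳ x) (order G ↑ʳ u)))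
      ≡⟨ cong₂ _+_ (trans (sum-cong-≗ (λ u → cong bit (adj-combine-ʳˡ x u))) (sum-bit-const (order G) b))
                   (trans (sum-cong-≗ (λ u → cong bit (adj-combine-ʳʳ x u))) (sym (deg-sum H x))) ⟩
    (if b then order G else 0) + deg H x                                ∎
    where open ≡-Reasoning

module _ {G H G′ H′ : Graph} {b b′ : Bool}
  (σ : Fin (order G) ⊎ Fin (order H) → Fin (order G′) ⊎ Fin (order H′))
  (σ⁻¹ : Fin (order G′) ⊎ Fin (order H′) → Fin (order G) ⊎ Fin (order H))
  (σσ⁻¹ : ∀ p → σ (σ⁻¹ p) ≡ p) (σ⁻¹σ : ∀ p → σ⁻¹ (σ p) ≡ p)
  (σ-adj : ∀ p q → adj⊎ G′ H′ b′ (σ p) (σ q) ≡ adj⊎ G H b p q) where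

  private
    σ↑ : Fin (order G + order H) → Fin (order G′ + order H′)
    σ↑ i = join (order G′) (order H′) (σ (splitAt (order G) i))

    σ⁻¹↑ : Fin (order G′ + order H′) → Fin (order G + order H)
    σ⁻¹↑ y = join (order G) (order H) (σ⁻¹ (splitAt (order G′) y))

  combine-≅ : combine G H b ≅ combine G′ H′ b′
  combine-≅ = mk≅ σ↑ σ⁻¹↑
    (λ y → begin
      join _ _ (σ (splitAt (order G) (join _ _ (σ⁻¹ (splitAt (order G′) y)))))
        ≡⟨ cong (join _ _ ∘ σ) (splitAt-join (order G) (order H) _) ⟩
      join _ _ (σ (σ⁻¹ (splitAt (order G′) y)))   ≡⟨ cong (join _ _) (σσ⁻¹ _) ⟩
      join _ _ (splitAt (order G′) y)             ≡⟨ join-splitAt (order G′) (order H′) y ⟩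
      y                                           ∎)
    (λ x → begin
      join _ _ (σ⁻¹ (splitAt (order G′) (join _ _ (σ (splitAt (order G) x)))))
        ≡⟨ cong (join _ _ ∘ σ⁻¹) (splitAt-join (order G′) (order H′) _) ⟩
      join _ _ (σ⁻¹ (σ (splitAt (order G) x)))    ≡⟨ cong (join _ _) (σ⁻¹σ _) ⟩
      join _ _ (splitAt (order G) x)              ≡⟨ join-splitAt (order G) (order H) x ⟩
      x                                           ∎)
    (λ i j → begin
      adj (combine G′ H′ b′) (σ↑ i) (σ↑ j)
        ≡⟨ adj-combine G′ H′ b′ (σ↑ i) (σ↑ j) ⟩
      adj⊎ G′ H′ b′ (splitAt (order G′) (σ↑ i)) (splitAt (order G′) (σ↑ j))
        ≡⟨ cong₂ (adj⊎ G′ H′ b′) (splitAt-join (order G′) (order H′) (σ (splitAt (order G) i))) (splitAt-join (order G′) (order H′) (σ (splitAt (order G) j))) ⟩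
      adj⊎ G′ H′ b′ (σ (splitAt (order G) i)) (σ (splitAt (order G) j))
        ≡⟨ σ-adj _ _ ⟩
      adj⊎ G H b (splitAt (order G) i) (splitAt (order G) j)
        ≡⟨ adj-combine G H b i j ⟨
      adj (combine G H b) i j ∎)
    where open ≡-Reasoning

  to-combine-≅ : ∀ p → to combine-≅ (join (order G) (order H) p) ≡ join (order G′) (order H′) (σ p)
  to-combine-≅ p = cong (join (order G′) (order H′) ∘ σ) (splitAt-join (order G) (order H) p)

module _ {A A′ B B′ : Graph} (f : A ≅ A′) (g : B ≅ B′) (b : Bool) where
  private
    σ : Fin (order A) ⊎ Fin (order B) → Fin (order A′) ⊎ Fin (order B′)
    σ = Sum.map (to f) (to g)
    σ⁻¹ : Fin (order A′) ⊎ Fin (order B′) → Fin (order A) ⊎ Fin (order B)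
    σ⁻¹ = Sum.map (from f) (from g)
    σσ⁻¹ : ∀ p → σ (σ⁻¹ p) ≡ p
    σσ⁻¹ (inj₁ x) = cong inj₁ (to-from f x)
    σσ⁻¹ (inj₂ x) = cong inj₂ (to-from g x)
    σ⁻¹σ : ∀ p → σ⁻¹ (σ p) ≡ p
    σ⁻¹σ (inj₁ x) = cong inj₁ (from-to f x)
    σ⁻¹σ (inj₂ x) = cong inj₂ (from-to g x)
    σ-adj : ∀ p q → adj⊎ A′ B′ b (σ p) (σ q) ≡ adj⊎ A B b p q
    σ-adj (inj₁ x) (inj₁ y) = to-adj f x y
    σ-adj (inj₁ x) (inj₂ y) = refl
    σ-adj (inj₂ x) (inj₁ y) = refl
    σ-adj (inj₂ x) (inj₂ y) = to-adj g x y

  combine-cong : combine A B b ≅ combine A′ B′ b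
  combine-cong = combine-≅ σ σ⁻¹ σσ⁻¹ σ⁻¹σ σ-adj

  to-combine-cong-ˡ : ∀ x → to combine-cong (x ↑ˡ order B) ≡ to f x ↑ˡ order B′
  to-combine-cong-ˡ x = to-combine-≅ σ σ⁻¹ σσ⁻¹ σ⁻¹σ σ-adj (inj₁ x)

module _ (A B : Graph) (b : Bool) where
  private
    swap-adj : ∀ p q → adj⊎ B A b (Sum.swap p) (Sum.swap q) ≡ adj⊎ A B b p q
    swap-adj (inj₁ x) (inj₁ y) = refl
    swap-adj (inj₁ x) (inj₂ y) = refl
    swap-adj (inj₂ x) (inj₁ y) = refl
    swap-adj (inj₂ x) (inj₂ y) = refl

  combine-comm : combine A B b ≅ combine B A b
  combine-comm = combine-≅ Sum.swap Sum.swap Sum.swap-involutive Sum.swap-involutive swap-adj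

  to-combine-comm-ˡ : ∀ x → to combine-comm (x ↑ˡ order B) ≡ order B ↑ʳ x
  to-combine-comm-ˡ x = to-combine-≅ Sum.swap Sum.swap Sum.swap-involutive Sum.swap-involutive swap-adj (inj₁ x)

-- Deleting and re-adding a vertex

delete : (G : Graph) → Fin (order G) → Graph
delete record { order = suc n ; adj = a ; sym = a-sym ; irrefl = a-irr } v =
  graph (λ i j → a (punchIn v i) (punchIn v j)) (λ i j → a-sym _ _) (λ i → a-irr _)

incl : (G : Graph) (v : Fin (order G)) → Fin (order (delete G v)) → Fin (order G)
incl record { order = suc n } = punchIn

adj-delete : (G : Graph) (v : Fin (order G)) (i j : Fin (order (delete G v))) →
  adj (delete G v) i j ≡ adj G (incl G v i) (incl G v j)
adj-delete record { order = suc n } v i j = refl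

incl≢ : (G : Graph) (v : Fin (order G)) (i : Fin (order (delete G v))) → incl G v i ≢ v
incl≢ record { order = suc n } = punchInᵢ≢i

incl-injective : (G : Graph) (v : Fin (order G)) → Injective _≡_ _≡_ (incl G v)
incl-injective record { order = suc n } v = punchIn-injective v _ _

incl⁻¹ : (G : Graph) (v w : Fin (order G)) → w ≢ v → Fin (order (delete G v))
incl⁻¹ record { order = suc n } v w w≢v = punchOut (w≢v ∘ sym)

incl-incl⁻¹ : (G : Graph) (v w : Fin (order G)) (w≢v : w ≢ v) → incl G v (incl⁻¹ G v w w≢v) ≡ w
incl-incl⁻¹ record { order = suc n } v w w≢v = punchIn-punchOut _

incl-≢ : (G : Graph) (c v : Fin (order G)) (v≢c : v ≢ c) {a : Fin (order (delete G c))} → a ≢ incl⁻¹ G c v v≢c → incl G c a ≢ v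
incl-≢ G c v v≢c a≢ eq = a≢ (incl-injective G c (trans eq (sym (incl-incl⁻¹ G c v v≢c))))

neighbourhood : (G : Graph) (v : Fin (order G)) → Fin (order (delete G v)) → Bool
neighbourhood G v u = adj G v (incl G v u)

deg-incl : (G : Graph) (v : Fin (order G)) (i : Fin (order (delete G v))) →
  deg G (incl G v i) ≡ bit (neighbourhood G v i) + deg (delete G v) i
deg-incl G@record { order = suc n ; adj = a } v i = begin
  deg G (punchIn v i)                                       ≡⟨ deg-sum G _ ⟩
  sum (λ u → bit (a (punchIn v i) u))                        ≡⟨ sum-remove {i = v} (λ u → bit (a (punchIn v i) u)) ⟩
  bit (a (punchIn v i) v) + sum (λ u → bit (a (punchIn v i) (punchIn v u)))
    ≡⟨ cong₂ _+_ (cong bit (adj-sym G _ _)) (sym (deg-sum (delete G v) i)) ⟩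
  bit (a v (punchIn v i)) + deg (delete G v) i              ∎
  where open ≡-Reasoning

deg-via-delete : (G : Graph) (v : Fin (order G)) → deg G v ≡ sum (λ i → bit (neighbourhood G v i))
deg-via-delete G@record { order = suc n ; adj = a } v = begin
  deg G v                                                    ≡⟨ deg-sum G v ⟩
  sum (λ u → bit (a v u))                                    ≡⟨ sum-remove {i = v} (λ u → bit (a v u)) ⟩
  bit (a v v) + sum (λ i → bit (a v (punchIn v i)))           ≡⟨ cong (λ b → bit b + sum (λ i → bit (a v (punchIn v i)))) (irrefl G v) ⟩
  sum (λ i → bit (a v (punchIn v i)))                         ∎
  where open ≡-Reasoning

module Peel (n : ℕ) (a : Fin (suc n) → Fin (suc n) → Bool) (a-sym : ∀ i j → a i j ≡ a j i) (a-irr : ∀ i → a i i ≡ false)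
            (v : Fin (suc n)) where
  G : Graph
  G = graph a a-sym a-irr

  v-first : Fin (suc n) → Fin (suc n)
  v-first u with u Fin.≟ v
  ... | yes _  = zero
  ... | no u≢v = suc (punchOut (u≢v ∘ sym))

  v-first⁻¹ : Fin (suc n) → Fin (suc n)
  v-first⁻¹ zero    = v
  v-first⁻¹ (suc x) = punchIn v x

  v-first-v : v-first v ≡ zero
  v-first-v with v Fin.≟ v
  ... | yes _  = refl
  ... | no v≢v = ⊥-elim (v≢v refl)

  v-first-punchIn : ∀ x → v-first (punchIn v x) ≡ suc x
  v-first-punchIn x with punchIn v x Fin.≟ v
  ... | yes eq = ⊥-elim (punchInᵢ≢i v x eq)
  ... | no _   = cong suc (trans (punchOut-cong v refl) (punchOut-punchIn v))

  v-first-v-first⁻¹ : ∀ y → v-first (v-first⁻¹ y) ≡ y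
  v-first-v-first⁻¹ zero    = v-first-v
  v-first-v-first⁻¹ (suc x) = v-first-punchIn x

  v-first⁻¹-v-first : ∀ u → v-first⁻¹ (v-first u) ≡ u
  v-first⁻¹-v-first u with u Fin.≟ v
  ... | yes u≡v = sym u≡v
  ... | no _    = punchIn-punchOut _

  v-first-adj : ∀ i j → adj (addVertex (delete G v) (neighbourhood G v)) (v-first i) (v-first j) ≡ a i j
  v-first-adj i j with i Fin.≟ v | j Fin.≟ v
  ... | yes refl | yes refl = sym (a-irr v)
  ... | yes refl | no _     = cong (a v) (punchIn-punchOut _)
  ... | no _     | yes refl = trans (cong (a v) (punchIn-punchOut _)) (a-sym v i)
  ... | no _     | no _     = cong₂ a (punchIn-punchOut _) (punchIn-punchOut _)

peel : (G : Graph) (v : Fin (order G)) → G ≅ addVertex (delete G v) (neighbourhood G v)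
peel record { order = suc n ; adj = a ; sym = a-sym ; irrefl = a-irr } v =
  mk≅ v-first v-first⁻¹ v-first-v-first⁻¹ v-first⁻¹-v-first v-first-adj
  where open Peel n a a-sym a-irr v

to-peel-self : (G : Graph) (v : Fin (order G)) → to (peel G v) v ≡ zero
to-peel-self record { order = suc n ; adj = a ; sym = a-sym ; irrefl = a-irr } v = Peel.v-first-v n a a-sym a-irr v

to-peel-incl : (G : Graph) (v : Fin (order G)) (x : Fin (order (delete G v))) → to (peel G v) (incl G v x) ≡ suc x
to-peel-incl record { order = suc n ; adj = a ; sym = a-sym ; irrefl = a-irr } v = Peel.v-first-punchIn n a a-sym a-irr v

module _ {H H′ : Graph} (φ : H ≅ H′) (s : Fin (order H) → Bool) (s′ : Fin (order H′) → Bool)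
         (s≡s′ : ∀ u → s u ≡ s′ (to φ u)) where
  private
    σ : Fin (suc (order H)) → Fin (suc (order H′))
    σ zero    = zero
    σ (suc u) = suc (to φ u)

    σ⁻¹ : Fin (suc (order H′)) → Fin (suc (order H))
    σ⁻¹ zero    = zero
    σ⁻¹ (suc u) = suc (from φ u)

    σσ⁻¹ : ∀ y → σ (σ⁻¹ y) ≡ y
    σσ⁻¹ zero    = refl
    σσ⁻¹ (suc y) = cong suc (to-from φ y)

    σ⁻¹σ : ∀ x → σ⁻¹ (σ x) ≡ x
    σ⁻¹σ zero    = refl
    σ⁻¹σ (suc x) = cong suc (from-to φ x)

    σ-adj : ∀ i j → adj (addVertex H′ s′) (σ i) (σ j) ≡ adj (addVertex H s) i j
    σ-adj zero    zero    = refl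
    σ-adj zero    (suc j) = sym (s≡s′ j)
    σ-adj (suc i) zero    = sym (s≡s′ i)
    σ-adj (suc i) (suc j) = to-adj φ i j

  addVertex-cong : addVertex H s ≅ addVertex H′ s′
  addVertex-cong = mk≅ σ σ⁻¹ σσ⁻¹ σ⁻¹σ σ-adj

addVertex-∪ : (A B : Graph) (s : Fin (order A + order B) → Bool) → (∀ y → s (order A ↑ʳ y) ≡ false) →
  addVertex (A ∪ B) s ≅ (addVertex A (λ x → s (x ↑ˡ order B)) ∪ B)
addVertex-∪ A B s s-B≡false = ≅-adj-cong (addVertex (A ∪ B) s) (adj A⁺∪B) (adj-sym A⁺∪B) (irrefl A⁺∪B) same-adj
  where
  A⁺∪B : Graph
  A⁺∪B = addVertex A (λ x → s (x ↑ˡ order B)) ∪ B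
  join-splitAtᵉ : ∀ (i : Fin (order A + order B)) {p} → splitAt (order A) i ≡ p → i ≡ join (order A) (order B) p
  join-splitAtᵉ i eq = trans (sym (join-splitAt (order A) (order B) i)) (cong (join (order A) (order B)) eq)
  same-adj : ∀ i j → adj A⁺∪B i j ≡ adj (addVertex (A ∪ B) s) i j
  same-adj zero    zero    = refl
  same-adj zero    (suc j) with splitAt (order A) j in eq
  ... | inj₁ x = cong s (sym (join-splitAtᵉ j eq))
  ... | inj₂ y = trans (sym (s-B≡false y)) (cong s (sym (join-splitAtᵉ j eq)))
  same-adj (suc i) zero    with splitAt (order A) i in eq
  ... | inj₁ x = cong s (sym (join-splitAtᵉ i eq))
  ... | inj₂ y = trans (sym (s-B≡false y)) (cong s (sym (join-splitAtᵉ i eq)))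
  same-adj (suc i) (suc j) with splitAt (order A) i | splitAt (order A) j
  ... | inj₁ _ | inj₁ _ = refl
  ... | inj₁ _ | inj₂ _ = refl
  ... | inj₂ _ | inj₁ _ = refl
  ... | inj₂ _ | inj₂ _ = refl

addVertex-universal : (H : Graph) → addVertex H (λ _ → true) ≅ (K₁ ∨G H)
addVertex-universal H = ≅-adj-cong (addVertex H (λ _ → true)) (adj (K₁ ∨G H)) (adj-sym (K₁ ∨G H)) (irrefl (K₁ ∨G H)) same-adj
  where
  same-adj : ∀ i j → adj (K₁ ∨G H) i j ≡ adj (addVertex H (λ _ → true)) i j
  same-adj zero    zero    = refl
  same-adj zero    (suc j) = refl
  same-adj (suc i) zero    = refl
  same-adj (suc i) (suc j) = refl

deg-addVertex-suc : (H : Graph) (s : Fin (order H) → Bool) (v : Fin (order H)) → deg (addVertex H s) (suc v) ≡ bit (s v) + deg H v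
deg-addVertex-suc H s v = trans (deg-sum (addVertex H s) (suc v)) (cong (bit (s v) +_) (sym (deg-sum H v)))

order-≅ : ∀ {G H} → G ≅ H → order G ≡ order H
order-≅ φ = ≤-antisym (injective⇒≤ (to-injective φ)) (injective⇒≤ (from-injective φ))

↑ˡ≢↑ʳ : ∀ {m n} (x : Fin m) (y : Fin n) → x ↑ˡ n ≢ m ↑ʳ y
↑ˡ≢↑ʳ {m} {n} x y eq with trans (sym (splitAt-↑ˡ m x n)) (trans (cong (splitAt m) eq) (splitAt-↑ʳ m n y))
... | ()

-- Splitting off components

record ComponentEmbedding (X R : Graph) (e : Fin (order X) → Fin (order R)) : Set where
  field
    e-injective : Injective _≡_ _≡_ e
    e-adj       : ∀ a b → adj R (e a) (e b) ≡ adj X a b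
    e-closed    : ∀ a w → adj R (e a) w ≡ true → ∃ λ b → w ≡ e b

record Splitting (X R : Graph) (e : Fin (order X) → Fin (order R)) : Set where
  field
    rest    : Graph
    split   : R ≅ (X ∪ rest)
    split-e : ∀ a → to split (e a) ≡ a ↑ˡ order rest


module _ {r : ℕ} {ax : Fin (suc r) → Fin (suc r) → Bool} {ax-sym : ∀ i j → ax i j ≡ ax j i} {ax-irr : ∀ i → ax i i ≡ false}
         {R : Graph} {e : Fin (suc r) → Fin (order R)}
         (c : ComponentEmbedding (graph ax ax-sym ax-irr) R e) where
  open ComponentEmbedding c

  private
    e-suc≢e-zero : ∀ b → e (suc b) ≢ e zero
    e-suc≢e-zero b eq with e-injective eq
    ... | ()

  e-rest : Fin r → Fin (order (delete R (e zero)))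
  e-rest b = incl⁻¹ R (e zero) (e (suc b)) (e-suc≢e-zero b)

  incl-e-rest : ∀ b → incl R (e zero) (e-rest b) ≡ e (suc b)
  incl-e-rest b = incl-incl⁻¹ R (e zero) (e (suc b)) (e-suc≢e-zero b)

  embedding-delete : ComponentEmbedding (delete (graph ax ax-sym ax-irr) zero)
                                        (delete R (e zero)) e-rest
  embedding-delete = record
    { e-injective = λ eq → Fin.suc-injective (e-injective (trans (sym (incl-e-rest _)) (trans (cong (incl R (e zero)) eq) (incl-e-rest _))))
    ; e-adj       = λ a b → trans (adj-delete R (e zero) (e-rest a) (e-rest b))
                                  (trans (cong₂ (adj R) (incl-e-rest a) (incl-e-rest b)) (e-adj (suc a) (suc b)))
    ; e-closed    = closed }
    where
    closed : ∀ a w → adj (delete R (e zero)) (e-rest a) w ≡ true → ∃ λ b → w ≡ e-rest b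
    closed a w ea~w with e-closed (suc a) (incl R (e zero) w)
                                  (trans (cong (λ x → adj R x (incl R (e zero) w)) (sym (incl-e-rest a)))
                                         (trans (sym (adj-delete R (e zero) (e-rest a) w)) ea~w))
    ... | zero  , eq = ⊥-elim (incl≢ R (e zero) w eq)
    ... | suc b , eq = b , incl-injective R (e zero) (trans eq (sym (incl-e-rest b)))

-- Induction on the size of X: peel e 0 off R and split the rest of X off what remains.  As every
-- neighbour of e 0 lies in the image of e, re-adding e 0 only touches the X-part.
splitting′ : ∀ r {X R : Graph} {e : Fin (order X) → Fin (order R)} → order X ≡ r → ComponentEmbedding X R e → Splitting X R e
splitting′ zero {X@record { order = _ }} {R} refl c = record
  { rest    = R
  ; split   = ≅-adj-cong R (adj (X ∪ R)) (adj-sym (X ∪ R)) (irrefl (X ∪ R)) (λ _ _ → refl)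
  ; split-e = λ () }
splitting′ (suc r) {X@record { order = _ }} {R} {e} refl c = record { rest = rest ; split = iso ; split-e = iso-e }
  where
  open ComponentEmbedding c
  v : Fin (order R)
  v = e zero
  X₀ : Graph
  X₀ = delete X zero
  open Splitting (splitting′ r refl (embedding-delete c)) using (rest) renaming (split to φ; split-e to φ-e)

  from-φ-e : ∀ x → from φ (x ↑ˡ order rest) ≡ e-rest c x
  from-φ-e x = trans (cong (from φ) (sym (φ-e x))) (from-to φ (e-rest c x))

  s : Fin (order (X₀ ∪ rest)) → Bool
  s = neighbourhood R v ∘ from φ

  s-X : ∀ x → s (x ↑ˡ order rest) ≡ neighbourhood X zero x
  s-X x = trans (cong (neighbourhood R v) (from-φ-e x)) (trans (cong (adj R v) (incl-e-rest c x)) (e-adj zero (suc x)))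

  s-rest : ∀ y → s (r ↑ʳ y) ≡ false
  s-rest y with adj R v (incl R v (from φ (r ↑ʳ y))) in v~
  ... | false = refl
  ... | true with e-closed zero _ v~
  ...   | zero  , eq = ⊥-elim (incl≢ R v _ eq)
  ...   | suc b , eq = ⊥-elim (↑ˡ≢↑ʳ b y (trans (sym (φ-e b)) (trans (cong (to φ) (sym from≡)) (to-from φ (r ↑ʳ y)))))
    where
    from≡ : from φ (r ↑ʳ y) ≡ e-rest c b
    from≡ = incl-injective R v (trans eq (sym (incl-e-rest c b)))

  A : addVertex (delete R v) (neighbourhood R v) ≅ addVertex (X₀ ∪ rest) s
  A = addVertex-cong φ (neighbourhood R v) s (λ u → cong (neighbourhood R v) (sym (from-to φ u)))

  B : addVertex X₀ (s ∘ (_↑ˡ order rest)) ≅ X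
  B = addVertex-cong ≅-refl (s ∘ (_↑ˡ order rest)) (neighbourhood X zero) s-X ⨾ ≅-sym (peel X zero)

  C : addVertex (X₀ ∪ rest) s ≅ (X ∪ rest)
  C = addVertex-∪ X₀ rest s s-rest ⨾ combine-cong B ≅-refl false

  iso : R ≅ (X ∪ rest)
  iso = peel R v ⨾ A ⨾ C

  iso-e : ∀ a → to iso (e a) ≡ a ↑ˡ order rest
  iso-e zero    = cong (to C ∘ to A) (to-peel-self R v)
  iso-e (suc a) = begin
    to iso (e (suc a))                                      ≡⟨ cong (to iso) (incl-e-rest c a) ⟨
    to C (to A (to (peel R v) (incl R v (e-rest c a))))     ≡⟨ cong (to C ∘ to A) (to-peel-incl R v (e-rest c a)) ⟩
    to (combine-cong B (≅-refl {rest}) false) (suc (to φ (e-rest c a)))  ≡⟨ cong (λ i → to (combine-cong B (≅-refl {rest}) false) (suc i)) (φ-e a) ⟩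
    to (combine-cong B (≅-refl {rest}) false) (suc a ↑ˡ order rest)  ≡⟨ to-combine-cong-ˡ B (≅-refl {rest}) false (suc a) ⟩
    suc a ↑ˡ order rest                                     ∎
    where open ≡-Reasoning

opaque
  splitting : ∀ {X R e} → ComponentEmbedding X R e → Splitting X R e
  splitting = splitting′ _ refl

mkComponentEmbedding : ∀ {X R} (e : Fin (order X) → Fin (order R)) → Injective _≡_ _≡_ e →
  (∀ a b → adj X a b ≡ true → adj R (e a) (e b) ≡ true) →
  (∀ a w → adj R (e a) w ≡ true → ∃ λ b → w ≡ e b × adj X a b ≡ true) →
  ComponentEmbedding X R e
mkComponentEmbedding {X} {R} e e-inj edges-kept nbrs-inside = record
  { e-injective = e-inj
  ; e-adj       = e-adj
  ; e-closed    = λ a w ea~w → Data.Product.map₂ proj₁ (nbrs-inside a w ea~w) }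
  where
  e-adj : ∀ a b → adj R (e a) (e b) ≡ adj X a b
  e-adj a b with adj X a b in a~b
  ... | true  = edges-kept a b a~b
  ... | false with adj R (e a) (e b) in ea~eb
  ...   | false = refl
  ...   | true with nbrs-inside a (e b) ea~eb
  ...   | b′ , eb≡eb′ , a~b′ with e-inj eb≡eb′
  ...     | refl with trans (sym a~b) a~b′
  ...       | ()

module SplittingProperties {X R : Graph} {e : Fin (order X) → Fin (order R)} (S : Splitting X R e) where
  open Splitting S public

  inRest : Fin (order rest) → Fin (order R)
  inRest a = from split (order X ↑ʳ a)

  deg-inRest : ∀ a → deg R (inRest a) ≡ deg rest a
  deg-inRest a = trans (deg-from split (order X ↑ʳ a)) (deg-combine-ʳ X rest false a)

  inRest≢e : ∀ a b → inRest a ≢ e b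
  inRest≢e a b eq = ↑ˡ≢↑ʳ b a (trans (sym (split-e b)) (trans (cong (to split) (sym eq)) (to-from split _)))


module _ (G : Graph) where

  isolated-¬adj : ∀ {v w} → deg G v ≡ 0 → adj G v w ≡ false
  isolated-¬adj {v} {w} deg≡0 with adj G v w in v~w
  ... | false = refl
  ... | true with neighbour-listed G deg≡0 (neighbours G 0 z≤n) v~w
  ...   | () , _

  leaf-neighbour : ∀ {v a w} → deg G v ≡ 1 → adj G v a ≡ true → adj G v w ≡ true → w ≡ a
  leaf-neighbour {v} {a} deg≡1 v~a v~w with neighbour-listed G deg≡1 N v~w
    where
    N : Neighbours G v 1
    N = record { nbr = a ∷ [] ; nbr-injective = ∷-injective (λ ()) []-injective ; nbr-adjacent = λ { zero → v~a } }
  ... | zero , w≡a = w≡a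

module _ (R : Graph) where

  empty-component : ∀ {k} (e : Fin k → Fin (order R)) → Injective _≡_ _≡_ e → (∀ b → deg R (e b) ≡ 0) →
    ComponentEmbedding (empty k) R e
  empty-component e e-inj isolated = mkComponentEmbedding e e-inj (λ _ _ ()) nbrs-inside
    where
    nbrs-inside : ∀ a w → adj R (e a) w ≡ true → ∃ λ b → w ≡ e b × false ≡ true
    nbrs-inside a w ea~w with trans (sym ea~w) (isolated-¬adj R (isolated a))
    ... | ()

  star-component : ∀ {k x} (N : Neighbours R x k) → deg R x ≡ k → (∀ b → deg R (Neighbours.nbr N b) ≡ 1) →
    ComponentEmbedding (star (suc k)) R (x ∷ Neighbours.nbr N)
  star-component {k} {x} N deg-x leaves = mkComponentEmbedding (x ∷ nbr) e-inj edges-kept nbrs-inside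
    where
    open Neighbours N
    e-inj : Injective _≡_ _≡_ (x ∷ nbr)
    e-inj = ∷-injective (λ b → adj⇒≢ R (nbr-adjacent b)) nbr-injective
    edges-kept : ∀ a b → adj (star (suc k)) a b ≡ true → adj R ((x ∷ nbr) a) ((x ∷ nbr) b) ≡ true
    edges-kept zero    zero    ()
    edges-kept zero    (suc b) _  = nbr-adjacent b
    edges-kept (suc a) zero    _  = adj-symᵗ R (nbr-adjacent a)
    edges-kept (suc a) (suc b) ()
    nbrs-inside : ∀ a w → adj R ((x ∷ nbr) a) w ≡ true → ∃ λ b → w ≡ (x ∷ nbr) b × adj (star (suc k)) a b ≡ true
    nbrs-inside zero    w x~w with neighbour-listed R deg-x N x~w
    ... | b , w≡ = suc b , w≡ , refl
    nbrs-inside (suc a) w a~w = zero , leaf-neighbour R (leaves a) (adj-symᵗ R (nbr-adjacent a)) a~w , refl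

  P₂-component : ∀ {v w} → deg R v ≡ 1 → deg R w ≡ 1 → adj R v w ≡ true → ComponentEmbedding P₂ R (v ∷ w ∷ [])
  P₂-component {v} {w} deg-v deg-w v~w = mkComponentEmbedding (v ∷ w ∷ []) e-inj edges-kept nbrs-inside
    where
    e-inj : Injective _≡_ _≡_ (v ∷ w ∷ [])
    e-inj = ∷-injective (λ { zero → adj⇒≢ R v~w }) (∷-injective (λ ()) []-injective)
    edges-kept : ∀ a b → adj P₂ a b ≡ true → adj R ((v ∷ w ∷ []) a) ((v ∷ w ∷ []) b) ≡ true
    edges-kept zero       (suc zero) _ = v~w
    edges-kept (suc zero) zero       _ = adj-symᵗ R v~w
    edges-kept zero       zero       ()
    edges-kept (suc zero) (suc zero) ()
    nbrs-inside : ∀ a u → adj R ((v ∷ w ∷ []) a) u ≡ true → ∃ λ b → u ≡ (v ∷ w ∷ []) b × adj P₂ a b ≡ true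
    nbrs-inside zero       u v~u = suc zero , leaf-neighbour R deg-v v~w v~u , refl
    nbrs-inside (suc zero) u w~u = zero , leaf-neighbour R deg-w (adj-symᵗ R v~w) w~u , refl

  deg≢⇒≢ : ∀ {u v p q} → deg R u ≡ p → deg R v ≡ q → p ≢ q → u ≢ v
  deg≢⇒≢ deg-u deg-v p≢q refl = p≢q (trans (sym deg-u) deg-v)

  P₄-component : ∀ {a x y b} → deg R a ≡ 1 → deg R x ≡ 2 → deg R y ≡ 2 → deg R b ≡ 1 →
    adj R a x ≡ true → adj R x y ≡ true → adj R y b ≡ true → a ≢ b → ComponentEmbedding P₄ R (a ∷ x ∷ y ∷ b ∷ [])
  P₄-component {a} {x} {y} {b} deg-a deg-x deg-y deg-b a~x x~y y~b a≢b =
    mkComponentEmbedding (a ∷ x ∷ y ∷ b ∷ []) e-inj edges-kept nbrs-inside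
    where
    e : Fin 4 → Fin (order R)
    e = a ∷ x ∷ y ∷ b ∷ []
    a≢y : a ≢ y
    a≢y = deg≢⇒≢ deg-a deg-y (λ ())
    x≢b : x ≢ b
    x≢b = deg≢⇒≢ deg-x deg-b (λ ())
    e-inj : Injective _≡_ _≡_ e
    e-inj = ∷-injective (λ { zero → adj⇒≢ R a~x ; (suc zero) → a≢y ; (suc (suc zero)) → a≢b })
           (∷-injective (λ { zero → adj⇒≢ R x~y ; (suc zero) → x≢b })
           (∷-injective (λ { zero → adj⇒≢ R y~b }) (∷-injective (λ ()) []-injective)))
    N-x : Neighbours R x 2
    N-x = record { nbr = a ∷ y ∷ [] ; nbr-injective = ∷-injective (λ { zero → a≢y }) (∷-injective (λ ()) []-injective)
                 ; nbr-adjacent = λ { zero → adj-symᵗ R a~x ; (suc zero) → x~y } }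
    N-y : Neighbours R y 2
    N-y = record { nbr = x ∷ b ∷ [] ; nbr-injective = ∷-injective (λ { zero → x≢b }) (∷-injective (λ ()) []-injective)
                 ; nbr-adjacent = λ { zero → adj-symᵗ R x~y ; (suc zero) → y~b } }
    edges-kept : ∀ i j → adj P₄ i j ≡ true → adj R (e i) (e j) ≡ true
    edges-kept 0F 1F _ = a~x
    edges-kept 1F 0F _ = adj-symᵗ R a~x
    edges-kept 1F 2F _ = x~y
    edges-kept 2F 1F _ = adj-symᵗ R x~y
    edges-kept 2F 3F _ = y~b
    edges-kept 3F 2F _ = adj-symᵗ R y~b
    edges-kept 3F 3F ()
    nbrs-inside : ∀ i w → adj R (e i) w ≡ true → ∃ λ j → w ≡ e j × adj P₄ i j ≡ true
    nbrs-inside 0F w a~w = 1F , leaf-neighbour R deg-a a~x a~w , refl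
    nbrs-inside 1F w x~w with neighbour-listed R deg-x N-x x~w
    ... | 0F , w≡ = 0F , w≡ , refl
    ... | 1F , w≡ = 2F , w≡ , refl
    nbrs-inside 2F w y~w with neighbour-listed R deg-y N-y y~w
    ... | 0F , w≡ = 1F , w≡ , refl
    ... | 1F , w≡ = 3F , w≡ , refl
    nbrs-inside 3F w b~w = 2F , leaf-neighbour R deg-b (adj-symᵗ R y~b) b~w , refl

≅-empty : (R : Graph) → order R ≡ 0 → R ≅ empty 0
≅-empty record { order = zero } refl = mk≅ (λ ()) (λ ()) (λ ()) (λ ()) (λ ())

order-copies-P₂ : ∀ j → order (copies j P₂) ≡ 2 * j
order-copies-P₂ zero    = refl
order-copies-P₂ (suc j) = trans (cong (2 +_) (order-copies-P₂ j)) (sym (*-suc 2 j))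

copies-P₂-of-1-regular : ∀ j (R : Graph) → order R ≡ 2 * j → (∀ v → deg R v ≡ 1) → R ≅ copies j P₂
copies-P₂-of-1-regular zero    R order≡ _      = ≅-empty R order≡
copies-P₂-of-1-regular (suc j) R order≡ 1-reg =
  split ⨾ combine-cong ≅-refl (copies-P₂-of-1-regular j rest order-rest (λ a → trans (sym (deg-inRest a)) (1-reg _))) false
  where
  v : Fin (order R)
  v = subst Fin (sym order≡) zero
  open Neighbours (neighbours R 1 (≤-reflexive (sym (1-reg v))))
  open SplittingProperties (splitting (P₂-component R (1-reg v) (1-reg (nbr 0F)) (nbr-adjacent 0F)))
  order-rest : order rest ≡ 2 * j
  order-rest = suc-injective (suc-injective (trans (sym (order-≅ split)) (trans order≡ (cong suc (+-suc j (j + 0))))))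

module _ {X Y R : Graph} {e₁ : Fin (order X) → Fin (order R)} {e₂ : Fin (order Y) → Fin (order R)}
         (c₁ : ComponentEmbedding X R e₁) (c₂ : ComponentEmbedding Y R e₂) (disjoint : ∀ a b → e₁ a ≢ e₂ b) where
  private
    module C₁ = ComponentEmbedding c₁
    module C₂ = ComponentEmbedding c₂

    E : Fin (order X) ⊎ Fin (order Y) → Fin (order R)
    E = Sum.[ e₁ , e₂ ]

    no-cross-edge : ∀ a b → adj R (e₁ a) (e₂ b) ≡ false
    no-cross-edge a b = Bool.¬-not λ e₁a~e₂b → case C₁.e-closed a (e₂ b) e₁a~e₂b of λ (c , eq) → disjoint c b (sym eq)

    E-injective : ∀ {p q} → E p ≡ E q → p ≡ q
    E-injective {inj₁ a} {inj₁ b} eq = cong inj₁ (C₁.e-injective eq)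
    E-injective {inj₁ a} {inj₂ b} eq = ⊥-elim (disjoint a b eq)
    E-injective {inj₂ a} {inj₁ b} eq = ⊥-elim (disjoint b a (sym eq))
    E-injective {inj₂ a} {inj₂ b} eq = cong inj₂ (C₂.e-injective eq)

    E-adj : ∀ p q → adj R (E p) (E q) ≡ adj⊎ X Y false p q
    E-adj (inj₁ a) (inj₁ b) = C₁.e-adj a b
    E-adj (inj₁ a) (inj₂ b) = no-cross-edge a b
    E-adj (inj₂ a) (inj₁ b) = trans (adj-sym R _ _) (no-cross-edge b a)
    E-adj (inj₂ a) (inj₂ b) = C₂.e-adj a b

    E-closed : ∀ p w → adj R (E p) w ≡ true → ∃ λ q → w ≡ E q
    E-closed (inj₁ a) w ea~w = Data.Product.map inj₁ id (C₁.e-closed a w ea~w)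
    E-closed (inj₂ a) w ea~w = Data.Product.map inj₂ id (C₂.e-closed a w ea~w)

  ∪-component : ComponentEmbedding (X ∪ Y) R (e₁ ++ e₂)
  ∪-component = record
    { e-injective = λ {i} {j} eq → trans (sym (join-splitAt (order X) (order Y) i))
                                     (trans (cong (join (order X) (order Y)) (E-injective {splitAt (order X) i} {splitAt (order X) j} eq)) (join-splitAt (order X) (order Y) j))
    ; e-adj       = λ i j → trans (E-adj (splitAt (order X) i) (splitAt (order X) j)) (sym (adj-combine X Y false i j))
    ; e-closed    = λ i w ei~w → case E-closed (splitAt (order X) i) w ei~w of λ
        (q , w≡) → join (order X) (order Y) q , trans w≡ (cong E (sym (splitAt-join (order X) (order Y) q))) }

order-parity : ∀ r k t → 2 * r + t ≤ 2 * k + t → r ≤ k × 2 * k + t ≡ (2 * r + t) + 2 * (k ∸ r)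
order-parity r k t le = r≤k , trans (cong (λ n → 2 * n + t) (sym (m+[n∸m]≡n r≤k))) (regroup r (k ∸ r) t)
  where
  r≤k : r ≤ k
  r≤k = *-cancelˡ-≤ 2 (+-cancelʳ-≤ t (2 * r) (2 * k) le)
  regroup : ∀ r d t → 2 * (r + d) + t ≡ (2 * r + t) + 2 * d
  regroup = solve-∀

module MatchingRest {X R : Graph} {e : Fin (order X) → Fin (order R)} (c : ComponentEmbedding X R e) (r k t : ℕ)
                    (order-X : order X ≡ 2 * r + t) (order-R : order R ≡ 2 * k + t)
                    (others-leaves : ∀ v → (∀ b → v ≢ e b) → deg R v ≡ 1) where
  open SplittingProperties (splitting c)
  private
    parity : r ≤ k × 2 * k + t ≡ (2 * r + t) + 2 * (k ∸ r)
    parity = order-parity r k t (subst₂ _≤_ order-X order-R (injective⇒≤ (ComponentEmbedding.e-injective c)))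

    order-rest : order rest ≡ 2 * (k ∸ r)
    order-rest = +-cancelˡ-≡ (order X) _ _ (trans (sym (order-≅ split))
                   (trans order-R (trans (proj₂ parity) (cong (_+ 2 * (k ∸ r)) (sym order-X)))))

    rest≅ : rest ≅ copies (k ∸ r) P₂
    rest≅ = copies-P₂-of-1-regular (k ∸ r) rest order-rest
              (λ a → trans (sym (deg-inRest a)) (others-leaves (inRest a) (inRest≢e a)))

  r≤k : r ≤ k
  r≤k = proj₁ parity

  iso : R ≅ (copies (k ∸ r) P₂ ∪ X)
  iso = split ⨾ combine-cong (≅-refl {X}) rest≅ false ⨾ combine-comm X (copies (k ∸ r) P₂) false

  to-iso-e : ∀ a → to iso (e a) ≡ order (copies (k ∸ r) P₂) ↑ʳ a
  to-iso-e a = begin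
    to iso (e a)                                                          ≡⟨ cong (to (combine-comm X (copies (k ∸ r) P₂) false) ∘ to (combine-cong (≅-refl {X}) rest≅ false)) (split-e a) ⟩
    to (combine-comm X (copies (k ∸ r) P₂) false) (to (combine-cong (≅-refl {X}) rest≅ false) (a ↑ˡ order rest))
                                                                          ≡⟨ cong (to (combine-comm X (copies (k ∸ r) P₂) false)) (to-combine-cong-ˡ (≅-refl {X}) rest≅ false a) ⟩
    to (combine-comm X (copies (k ∸ r) P₂) false) (a ↑ˡ order (copies (k ∸ r) P₂))
                                                                          ≡⟨ to-combine-comm-ˡ X (copies (k ∸ r) P₂) false a ⟩
    order (copies (k ∸ r) P₂) ↑ʳ a                                        ∎
    where open ≡-Reasoning

module _ (R : Graph) where

  K₁-component : ∀ {u} → deg R u ≡ 0 → ComponentEmbedding K₁ R (u ∷ [])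
  K₁-component deg-u = empty-component R (_ ∷ []) (∷-injective (λ ()) []-injective) (λ { zero → deg-u })

  isolated-≢-neighbour : ∀ {u v w} → deg R u ≡ 0 → adj R v w ≡ true → w ≢ u
  isolated-≢-neighbour {u} {v} deg-u v~w refl with trans (sym (adj-symᵗ R v~w)) (isolated-¬adj R deg-u)
  ... | ()

  private
    star-≢-isolated : ∀ {k x u} (N : Neighbours R x (suc k)) → deg R u ≡ 0 → deg R x ≡ suc k →
      ∀ a b → (x ∷ Neighbours.nbr N) a ≢ (u ∷ []) b
    star-≢-isolated N deg-u deg-x zero    zero = deg≢⇒≢ R deg-x deg-u (λ ())
    star-≢-isolated N deg-u deg-x (suc b) zero = isolated-≢-neighbour deg-u (Neighbours.nbr-adjacent N b)

  residual-F₁ : ∀ k → order R ≡ 2 * k + 1 → ∀ u → deg R u ≡ 0 → (∀ a → a ≢ u → deg R a ≡ 1) →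
    Σ (R ≅ (copies k P₂ ∪ K₁)) λ φ → to φ u ≡ order (copies k P₂) ↑ʳ zero
  residual-F₁ k order-R u deg-u others = iso , to-iso-e zero
    where open MatchingRest (K₁-component deg-u) 0 k 1 refl order-R (λ v v∉ → others v (v∉ 0F))

  residual-E₂ : ∀ k → order R ≡ 2 * k + 0 → ∀ u x → deg R u ≡ 0 → deg R x ≡ 2 → (∀ a → a ≢ u → a ≢ x → deg R a ≡ 1) →
    2 ≤ k × R ≅ (copies (k ∸ 2) P₂ ∪ S₃ ∪ K₁)
  residual-E₂ k order-R u x deg-u deg-x others = r≤k , iso
    where
    N : Neighbours R x 2
    N = neighbours R 2 (≤-reflexive (sym deg-x))
    open Neighbours N
    leaf : ∀ b → deg R (nbr b) ≡ 1
    leaf b = others (nbr b) (isolated-≢-neighbour deg-u (nbr-adjacent b)) (adj⇒≢ R (nbr-adjacent b) ∘ sym)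
    open MatchingRest (∪-component (star-component R N deg-x leaf) (K₁-component deg-u) (star-≢-isolated N deg-u deg-x))
                      2 k 0 refl order-R (λ v v∉ → others v (v∉ 3F) (v∉ 0F))

  residual-H₃ : ∀ k → order R ≡ 2 * k + 1 → ∀ x → deg R x ≡ 2 → (∀ a → a ≢ x → deg R a ≡ 1) →
    1 ≤ k × R ≅ (copies (k ∸ 1) P₂ ∪ S₃)
  residual-H₃ k order-R x deg-x others = r≤k , iso
    where
    N : Neighbours R x 2
    N = neighbours R 2 (≤-reflexive (sym deg-x))
    open Neighbours N
    leaf : ∀ b → deg R (nbr b) ≡ 1
    leaf b = others (nbr b) (adj⇒≢ R (nbr-adjacent b) ∘ sym)
    open MatchingRest (star-component R N deg-x leaf) 1 k 1 refl order-R (λ v v∉ → others v (v∉ 0F))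

  residual-H₄ : ∀ k → order R ≡ 2 * k + 1 → ∀ u x → deg R u ≡ 0 → deg R x ≡ 3 → (∀ a → a ≢ u → a ≢ x → deg R a ≡ 1) →
    2 ≤ k × R ≅ (copies (k ∸ 2) P₂ ∪ S₄ ∪ K₁)
  residual-H₄ k order-R u x deg-u deg-x others = r≤k , iso
    where
    N : Neighbours R x 3
    N = neighbours R 3 (≤-reflexive (sym deg-x))
    open Neighbours N
    leaf : ∀ b → deg R (nbr b) ≡ 1
    leaf b = others (nbr b) (isolated-≢-neighbour deg-u (nbr-adjacent b)) (adj⇒≢ R (nbr-adjacent b) ∘ sym)
    open MatchingRest (∪-component (star-component R N deg-x leaf) (K₁-component deg-u) (star-≢-isolated N deg-u deg-x))
                      2 k 1 refl order-R (λ v v∉ → others v (v∉ 4F) (v∉ 0F))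

  residual-L₁ : ∀ k → order R ≡ 2 * k + 1 → ∀ x y z → deg R x ≡ 0 → deg R y ≡ 0 → deg R z ≡ 0 →
    x ≢ y → x ≢ z → y ≢ z → (∀ a → a ≢ x → a ≢ y → a ≢ z → deg R a ≡ 1) →
    1 ≤ k × Σ (R ≅ (copies (k ∸ 1) P₂ ∪ empty 3)) λ φ →
      to φ y ≡ order (copies (k ∸ 1) P₂) ↑ʳ 1F × to φ z ≡ order (copies (k ∸ 1) P₂) ↑ʳ 2F
  residual-L₁ k order-R x y z deg-x deg-y deg-z x≢y x≢z y≢z others = r≤k , iso , to-iso-e 1F , to-iso-e 2F
    where
    e-inj : Injective _≡_ _≡_ (x ∷ y ∷ z ∷ [])
    e-inj = ∷-injective (λ { 0F → x≢y ; 1F → x≢z }) (∷-injective (λ { 0F → y≢z }) (∷-injective (λ ()) []-injective))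
    isolated : ∀ b → deg R ((x ∷ y ∷ z ∷ []) b) ≡ 0
    isolated 0F = deg-x
    isolated 1F = deg-y
    isolated 2F = deg-z
    open MatchingRest (empty-component R (x ∷ y ∷ z ∷ []) e-inj isolated)
                      1 k 1 refl order-R (λ v v∉ → others v (v∉ 0F) (v∉ 1F) (v∉ 2F))

  other-neighbour : ∀ {x} y → deg R x ≡ 2 → ∃ λ a → a ≢ y × adj R x a ≡ true
  other-neighbour {x} y deg-x = pick (neighbours R 2 (≤-reflexive (sym deg-x)))
    where
    pick : Neighbours R x 2 → ∃ λ a → a ≢ y × adj R x a ≡ true
    pick record { nbr = nbr ; nbr-injective = nbr-inj ; nbr-adjacent = x~nbr } with nbr 0F Fin.≟ y
    ... | no  a≢y  = nbr 0F , a≢y , x~nbr 0F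
    ... | yes refl = nbr 1F , (λ eq → case nbr-inj eq of λ ()) , x~nbr 1F

  residual-H₅ : ∀ k → order R ≡ 2 * k + 1 → ∀ u x y → deg R u ≡ 0 → deg R x ≡ 2 → deg R y ≡ 2 → adj R x y ≡ true →
    (∀ a → a ≢ u → a ≢ x → a ≢ y → deg R a ≡ 1) → 2 ≤ k × R ≅ (copies (k ∸ 2) P₂ ∪ (P₄ ∪ K₁))
  residual-H₅ k order-R u x y deg-u deg-x deg-y x~y others
    with a , a≢y , x~a ← other-neighbour y deg-x
    with b , b≢x , y~b ← other-neighbour x deg-y = r≤k , iso
    where
    deg-a : deg R a ≡ 1
    deg-a = others a (isolated-≢-neighbour deg-u x~a) (adj⇒≢ R x~a ∘ sym) a≢y
    deg-b : deg R b ≡ 1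
    deg-b = others b (isolated-≢-neighbour deg-u y~b) b≢x (adj⇒≢ R y~b ∘ sym)
    a≢b : a ≢ b
    a≢b refl = adj⇒≢ R x~y (leaf-neighbour R deg-a (adj-symᵗ R y~b) (adj-symᵗ R x~a))
    path≢u : ∀ i j → (a ∷ x ∷ y ∷ b ∷ []) i ≢ (u ∷ []) j
    path≢u 0F zero = isolated-≢-neighbour deg-u x~a
    path≢u 1F zero = deg≢⇒≢ R deg-x deg-u (λ ())
    path≢u 2F zero = deg≢⇒≢ R deg-y deg-u (λ ())
    path≢u 3F zero = isolated-≢-neighbour deg-u y~b
    open MatchingRest (∪-component (P₄-component R deg-a deg-x deg-y deg-b (adj-symᵗ R x~a) x~y y~b a≢b) (K₁-component deg-u)
                                   path≢u)
                      2 k 1 refl order-R (λ v v∉ → others v (v∉ 4F) (v∉ 1F) (v∉ 2F))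

  residual-H₆ : ∀ k → order R ≡ 2 * k + 1 → ∀ u x y → deg R u ≡ 0 → deg R x ≡ 2 → deg R y ≡ 2 → x ≢ y → adj R x y ≡ false →
    (∀ a → a ≢ u → a ≢ x → a ≢ y → deg R a ≡ 1) → 3 ≤ k × R ≅ (copies (k ∸ 3) P₂ ∪ (copies 2 S₃ ∪ K₁))
  residual-H₆ k order-R u x y deg-u deg-x deg-y x≢y x≁y others = r≤k , iso
    where
    N-x : Neighbours R x 2
    N-x = neighbours R 2 (≤-reflexive (sym deg-x))
    N-y : Neighbours R y 2
    N-y = neighbours R 2 (≤-reflexive (sym deg-y))
    module X = Neighbours N-x
    module Y = Neighbours N-y
    x≢nbrY : ∀ b → x ≢ Y.nbr b
    x≢nbrY b refl with trans (sym (adj-symᵗ R (Y.nbr-adjacent b))) x≁y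
    ... | ()
    nbrX≢y : ∀ a → X.nbr a ≢ y
    nbrX≢y a refl with trans (sym (X.nbr-adjacent a)) x≁y
    ... | ()
    leafX : ∀ b → deg R (X.nbr b) ≡ 1
    leafX b = others _ (isolated-≢-neighbour deg-u (X.nbr-adjacent b)) (adj⇒≢ R (X.nbr-adjacent b) ∘ sym) (nbrX≢y b)
    leafY : ∀ b → deg R (Y.nbr b) ≡ 1
    leafY b = others _ (isolated-≢-neighbour deg-u (Y.nbr-adjacent b)) (x≢nbrY b ∘ sym) (adj⇒≢ R (Y.nbr-adjacent b) ∘ sym)
    common-leaf : ∀ a b → X.nbr a ≢ Y.nbr b
    common-leaf a b eq =
      x≢y (sym (leaf-neighbour R (leafX a) (adj-symᵗ R (X.nbr-adjacent a)) (subst (λ w → adj R w y ≡ true) (sym eq) (adj-symᵗ R (Y.nbr-adjacent b)))))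
    stars-disjoint : ∀ a b → (x ∷ X.nbr) a ≢ ((y ∷ Y.nbr) ++ []) b
    stars-disjoint 0F      0F = x≢y
    stars-disjoint 0F      1F = x≢nbrY 0F
    stars-disjoint 0F      2F = x≢nbrY 1F
    stars-disjoint (suc a) 0F = nbrX≢y a
    stars-disjoint (suc a) 1F = common-leaf a 0F
    stars-disjoint (suc a) 2F = common-leaf a 1F
    stars≢u : ∀ i j → ((x ∷ X.nbr) ++ ((y ∷ Y.nbr) ++ [])) i ≢ (u ∷ []) j
    stars≢u 0F zero = deg≢⇒≢ R deg-x deg-u (λ ())
    stars≢u 1F zero = isolated-≢-neighbour deg-u (X.nbr-adjacent 0F)
    stars≢u 2F zero = isolated-≢-neighbour deg-u (X.nbr-adjacent 1F)
    stars≢u 3F zero = deg≢⇒≢ R deg-y deg-u (λ ())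
    stars≢u 4F zero = isolated-≢-neighbour deg-u (Y.nbr-adjacent 0F)
    stars≢u 5F zero = isolated-≢-neighbour deg-u (Y.nbr-adjacent 1F)
    two-stars : ComponentEmbedding (copies 2 S₃) R ((x ∷ X.nbr) ++ ((y ∷ Y.nbr) ++ []))
    two-stars = ∪-component (star-component R N-x deg-x leafX)
                  (∪-component (star-component R N-y deg-y leafY) (empty-component R [] []-injective (λ ())) (λ _ ()))
                  stars-disjoint
    open MatchingRest (∪-component two-stars (K₁-component deg-u) stars≢u)
                      3 k 1 refl order-R (λ v v∉ → others v (v∉ 6F) (v∉ 0F) (v∉ 3F))

-- Maximum degree, handshake and the counting identity

module _ {A : Set} (h : A → ℕ) where

  foldr-⊔-≥ : ∀ {n} (g : Fin n → A) i → h (g i) ≤ List.foldr (λ v acc → h v ⊔ acc) 0 (List.tabulate g)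
  foldr-⊔-≥ g zero    = m≤m⊔n (h (g zero)) _
  foldr-⊔-≥ g (suc i) = ≤-trans (foldr-⊔-≥ (g ∘ suc) i) (m≤n⊔m (h (g zero)) _)

  foldr-⊔-attained : ∀ {n} (g : Fin (suc n) → A) → ∃ λ i → h (g i) ≡ List.foldr (λ v acc → h v ⊔ acc) 0 (List.tabulate g)
  foldr-⊔-attained {zero}  g = zero , sym (⊔-identityʳ (h (g zero)))
  foldr-⊔-attained {suc n} g with foldr-⊔-attained (g ∘ suc) | ≤-total (h (g zero)) (List.foldr (λ v acc → h v ⊔ acc) 0 (List.tabulate (g ∘ suc)))
  ... | i , eq | inj₁ le = suc i , trans eq (sym (m≤n⇒m⊔n≡n le))
  ... | _ , _  | inj₂ ge = zero , sym (m≥n⇒m⊔n≡m ge)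

deg≤maxDeg : (G : Graph) (v : Fin (order G)) → deg G v ≤ maxDeg G
deg≤maxDeg G = foldr-⊔-≥ (deg G) id

maxDeg-attained : (G : Graph) → 1 ≤ order G → ∃ λ c → deg G c ≡ maxDeg G
maxDeg-attained G@record { order = suc n } _ = foldr-⊔-attained (deg G) id

≤⇒≤ᵇ≡true : ∀ {m n} → m ≤ n → (m ≤ᵇ n) ≡ true
≤⇒≤ᵇ≡true m≤n = Equivalence.to Bool.T-≡ (≤⇒≤ᵇ m≤n)

≰⇒≤ᵇ≡false : ∀ {m n} → ¬ (m ≤ n) → (m ≤ᵇ n) ≡ false
≰⇒≤ᵇ≡false {m} {n} m≰n = Bool.¬-not (λ eq → m≰n (≤ᵇ⇒≤ m n (Equivalence.from Bool.T-≡ eq)))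

≡⇒≡ᵇ≡true : ∀ {m n} → m ≡ n → (m ≡ᵇ n) ≡ true
≡⇒≡ᵇ≡true {m} {n} m≡n = Equivalence.to Bool.T-≡ (≡⇒≡ᵇ m n m≡n)

≢⇒≡ᵇ≡false : ∀ {m n} → m ≢ n → (m ≡ᵇ n) ≡ false
≢⇒≡ᵇ≡false {m} {n} m≢n = Bool.¬-not (λ eq → m≢n (≡ᵇ⇒≡ m n (Equivalence.from Bool.T-≡ eq)))

handshake : (G : Graph) → sum (deg G) ≡ 2 * edges G
handshake G = begin
  sum (deg G)                                        ≡⟨ sum-cong-≗ (deg-sum G) ⟩
  sum (λ i → sum (λ j → bit (adj G i j)))            ≡⟨ sum-cong-≗ (λ i → trans (sum-cong-≗ (split i)) (∑-distrib-+ (E i) (λ j → E j i))) ⟩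
  sum (λ i → sum (E i) + sum (λ j → E j i))           ≡⟨ ∑-distrib-+ (λ i → sum (E i)) (λ i → sum (λ j → E j i)) ⟩
  sum (λ i → sum (E i)) + sum (λ i → sum (λ j → E j i))
                                                     ≡⟨ cong (sum (λ i → sum (E i)) +_) (∑-comm (λ i j → E j i)) ⟩
  sum (λ i → sum (E i)) + sum (λ j → sum (E j))     ≡⟨ cong₂ _+_ (sym edges-sum) (trans (sym edges-sum) (sym (+-identityʳ _))) ⟩
  edges G + (edges G + 0)                            ∎
  where
  open ≡-Reasoning
  n : ℕ
  n = order G
  E : Fin n → Fin n → ℕ
  E i j = if suc (toℕ i) ≤ᵇ toℕ j then bit (adj G i j) else 0
  edges-sum : edges G ≡ sum (λ i → sum (E i))
  edges-sum = trans (listSum-allFin (λ i → List.sum (List.map (E i) (List.allFin n)))) (sum-cong-≗ (λ i → listSum-allFin (E i)))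
  split : ∀ i j → bit (adj G i j) ≡ E i j + E j i
  split i j with <-cmp (toℕ i) (toℕ j)
  ... | tri< lt _ ngt rewrite ≤⇒≤ᵇ≡true lt | ≰⇒≤ᵇ≡false ngt = sym (+-identityʳ _)
  ... | tri> nlt _ gt rewrite ≰⇒≤ᵇ≡false nlt | ≤⇒≤ᵇ≡true gt = cong bit (adj-sym G i j)
  ... | tri≈ _ eq _ rewrite Fin.toℕ-injective {i = i} {j = j} eq | irrefl G j with suc (toℕ j) ≤ᵇ toℕ j
  ...   | true  = refl
  ...   | false = refl

[r+q*3]/3≡q : ∀ q r → r < 3 → (r + q * 3) / 3 ≡ q
[r+q*3]/3≡q q r r<3 = trans (+-distrib-/-∣ʳ r (divides-refl q)) (cong₂ _+_ (m<n⇒m/n≡0 r<3) (m*n/n≡m q 3))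

⌊2m+1/3⌋-3k : ∀ k → (2 * (3 * k) + 1) / 3 ≡ 2 * k
⌊2m+1/3⌋-3k k = trans (cong (_/ 3) (regroup k)) ([r+q*3]/3≡q (2 * k) 1 (s≤s (s≤s z≤n)))
  where
  regroup : ∀ k → 2 * (3 * k) + 1 ≡ 1 + 2 * k * 3
  regroup = solve-∀

⌊2m+1/3⌋-3k+1 : ∀ k → (2 * (3 * k + 1) + 1) / 3 ≡ 2 * k + 1
⌊2m+1/3⌋-3k+1 k = trans (cong (_/ 3) (regroup k)) ([r+q*3]/3≡q (2 * k + 1) 0 (s≤s z≤n))
  where
  regroup : ∀ k → 2 * (3 * k + 1) + 1 ≡ 0 + (2 * k + 1) * 3
  regroup = solve-∀

⌊2m+1/3⌋-3k+2 : ∀ k → (2 * (3 * k + 2) + 1) / 3 ≡ 2 * k + 1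
⌊2m+1/3⌋-3k+2 k = trans (cong (_/ 3) (regroup k)) ([r+q*3]/3≡q (2 * k + 1) 2 (s≤s (s≤s (s≤s z≤n))))
  where
  regroup : ∀ k → 2 * (3 * k + 2) + 1 ≡ 2 + (2 * k + 1) * 3
  regroup = solve-∀

3*≤⇒≤/3 : ∀ Δ n → 3 * Δ ≤ n → Δ ≤ n / 3
3*≤⇒≤/3 Δ n 3Δ≤n = subst (_≤ n / 3) (m*n/n≡m Δ 3) (/-monoˡ-≤ 3 (subst (_≤ n) (*-comm 3 Δ) 3Δ≤n))

≡0⇒≤1 : ∀ {n} → n ≡ 0 → n ≤ 1
≡0⇒≤1 refl = z≤n

leafCount : ℕ → ℕ
leafCount 1 = 1
leafCount _ = 0

leafCount≤1 : ∀ n → leafCount n ≤ 1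
leafCount≤1 0             = z≤n
leafCount≤1 1             = ≤-refl
leafCount≤1 (suc (suc n)) = z≤n

leafCount≡1⇒≡1 : ∀ n → leafCount n ≡ 1 → n ≡ 1
leafCount≡1⇒≡1 1 _ = refl

≢1⇒leafCount≡0 : ∀ n → n ≢ 1 → leafCount n ≡ 0
≢1⇒leafCount≡0 0             _   = refl
≢1⇒leafCount≡0 1             n≢1 = ⊥-elim (n≢1 refl)
≢1⇒leafCount≡0 (suc (suc n)) _   = refl

+leafCount≡2 : ∀ n → n + leafCount n ≡ 2 → n ≡ 1 ⊎ n ≡ 2
+leafCount≡2 1 _ = inj₁ refl
+leafCount≡2 2 _ = inj₂ refl
+leafCount≡2 (suc (suc (suc n))) ()

+leafCount≡3+ : ∀ n j → n + leafCount n ≡ 3 + j → n ≡ 3 + j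
+leafCount≡3+ (suc (suc (suc n))) j eq = trans (sym (+-identityʳ _)) eq

module Defect (G : Graph) (no-isolated : ∀ v → ¬ (deg G v ≡ 0))
              (one-leaf : ∀ u v → deg G u ≡ 1 → deg G v ≡ 1 → u ≡ v) (c : Fin (order G)) where

  Δ : ℕ
  Δ = deg G c

  ℓ : ℕ
  ℓ = sum (leafCount ∘ deg G)

  ℓ≤1 : ℓ ≤ 1
  ℓ≤1 = sum≤1 (leafCount ∘ deg G) (λ v → leafCount≤1 (deg G v))
          (λ u v u-leaf v-leaf → one-leaf u v (leafCount≡1⇒≡1 _ u-leaf) (leafCount≡1⇒≡1 _ v-leaf))

  charge : Fin (order G) → ℕ
  charge v = deg G v + leafCount (deg G v)

  weight : Fin (order G) → ℕ
  weight v = Δ * δ v c + 2 * bit (adj G c v)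

  2≤charge : ∀ v → 2 ≤ charge v
  2≤charge v with deg G v in deg≡
  ... | 0           = ⊥-elim (no-isolated v deg≡)
  ... | 1           = ≤-refl
  ... | suc (suc _) = s≤s (s≤s z≤n)

  weight≤charge : ∀ v → weight v ≤ charge v
  weight≤charge v with v Fin.≟ c
  ... | yes refl rewrite irrefl G c = ≤-trans (≤-reflexive (trans (+-identityʳ _) (*-identityʳ Δ))) (m≤m+n Δ _)
  ... | no  v≢c with adj G c v
  ...   | true  = subst (_≤ charge v) (sym (cong (_+ 2) (*-zeroʳ Δ))) (2≤charge v)
  ...   | false = subst (_≤ charge v) (sym (trans (+-identityʳ _) (*-zeroʳ Δ))) z≤n

  defect : Fin (order G) → ℕ
  defect v = charge v ∸ weight v

  charge≡weight+defect : ∀ v → charge v ≡ weight v + defect v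
  charge≡weight+defect v = sym (m+[n∸m]≡n (weight≤charge v))

  sum-weight : sum weight ≡ 3 * Δ
  sum-weight = begin
    sum weight                                                 ≡⟨ ∑-distrib-+ (λ v → Δ * δ v c) (λ v → 2 * bit (adj G c v)) ⟩
    sum (λ v → Δ * δ v c) + sum (λ v → 2 * bit (adj G c v))     ≡⟨ cong₂ _+_ (*-distribˡ-sum Δ (λ v → δ v c)) (*-distribˡ-sum 2 (λ v → bit (adj G c v))) ⟨
    Δ * sum (λ v → δ v c) + 2 * sum (λ v → bit (adj G c v))     ≡⟨ cong₂ (λ s t → Δ * s + 2 * t) (sum-δ c) (sym (deg-sum G c)) ⟩
    Δ * 1 + 2 * Δ                                              ≡⟨ solve-3 Δ ⟩
    3 * Δ                                                      ∎
    where
    open ≡-Reasoning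
    solve-3 : ∀ Δ → Δ * 1 + 2 * Δ ≡ 3 * Δ
    solve-3 = solve-∀

  2m+ℓ≡3Δ+defect : 2 * edges G + ℓ ≡ 3 * Δ + sum defect
  2m+ℓ≡3Δ+defect = begin
    2 * edges G + ℓ                          ≡⟨ cong (_+ ℓ) (handshake G) ⟨
    sum (deg G) + ℓ                          ≡⟨ ∑-distrib-+ (deg G) (leafCount ∘ deg G) ⟨
    sum charge                               ≡⟨ sum-cong-≗ charge≡weight+defect ⟩
    sum (λ v → weight v + defect v)          ≡⟨ ∑-distrib-+ weight defect ⟩
    sum weight + sum defect                  ≡⟨ cong (_+ sum defect) sum-weight ⟩
    3 * Δ + sum defect                       ∎
    where open ≡-Reasoning

  3Δ≤2m+1 : 3 * Δ ≤ 2 * edges G + 1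
  3Δ≤2m+1 = ≤-trans (m≤m+n (3 * Δ) (sum defect)) (≤-trans (≤-reflexive (sym 2m+ℓ≡3Δ+defect)) (+-monoʳ-≤ (2 * edges G) ℓ≤1))

  weight-nbr : ∀ {v} → v ≢ c → adj G c v ≡ true → weight v ≡ 2
  weight-nbr v≢c c~v rewrite δ-≢ v≢c | c~v = cong (_+ 2) (*-zeroʳ Δ)

  weight-non-nbr : ∀ {v} → v ≢ c → adj G c v ≡ false → weight v ≡ 0
  weight-non-nbr v≢c c≁v rewrite δ-≢ v≢c | c≁v = trans (+-identityʳ _) (*-zeroʳ Δ)

  charge-nbr : ∀ {v} → v ≢ c → adj G c v ≡ true → charge v ≡ 2 + defect v
  charge-nbr {v} v≢c c~v = trans (charge≡weight+defect v) (cong (_+ defect v) (weight-nbr v≢c c~v))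

  charge-non-nbr : ∀ {v} → v ≢ c → adj G c v ≡ false → charge v ≡ defect v
  charge-non-nbr {v} v≢c c≁v = trans (charge≡weight+defect v) (cong (_+ defect v) (weight-non-nbr v≢c c≁v))

  defect≤1⇒adjacent : ∀ {v} → v ≢ c → defect v ≤ 1 → adj G c v ≡ true
  defect≤1⇒adjacent {v} v≢c defect≤1 = Bool.¬-not λ c≁v →
    <⇒≱ (s≤s defect≤1) (≤-trans (2≤charge v) (≤-reflexive (charge-non-nbr v≢c c≁v)))

  defect-centre : 2 ≤ Δ → defect c ≡ 0
  defect-centre 2≤Δ = +-cancelˡ-≡ Δ (defect c) 0 (begin
    Δ + defect c            ≡⟨ cong (_+ defect c) weight-c ⟨
    weight c + defect c     ≡⟨ charge≡weight+defect c ⟨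
    Δ + leafCount Δ         ≡⟨ cong (Δ +_) (≢1⇒leafCount≡0 Δ (λ Δ≡1 → <⇒≱ 2≤Δ (≤-reflexive Δ≡1))) ⟩
    Δ + 0                   ∎)
    where
    open ≡-Reasoning
    weight-c : weight c ≡ Δ
    weight-c rewrite δ-refl c | irrefl G c = trans (+-identityʳ _) (*-identityʳ Δ)

  deg-nbr-defect0 : ∀ {v} → v ≢ c → adj G c v ≡ true → defect v ≡ 0 → deg G v ≡ 1 ⊎ deg G v ≡ 2
  deg-nbr-defect0 v≢c c~v defect≡0 = +leafCount≡2 _ (trans (charge-nbr v≢c c~v) (cong (2 +_) defect≡0))

  deg-nbr-defect1 : ∀ {v} → v ≢ c → adj G c v ≡ true → defect v ≡ 1 → deg G v ≡ 3
  deg-nbr-defect1 v≢c c~v defect≡1 = +leafCount≡3+ _ 0 (trans (charge-nbr v≢c c~v) (cong (2 +_) defect≡1))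

  deg-nbr-defect2 : ∀ {v} → v ≢ c → adj G c v ≡ true → defect v ≡ 2 → deg G v ≡ 4
  deg-nbr-defect2 v≢c c~v defect≡2 = +leafCount≡3+ _ 1 (trans (charge-nbr v≢c c~v) (cong (2 +_) defect≡2))

  deg-non-nbr-defect2 : ∀ {v} → v ≢ c → adj G c v ≡ false → defect v ≡ 2 → deg G v ≡ 1 ⊎ deg G v ≡ 2
  deg-non-nbr-defect2 v≢c c≁v defect≡2 = +leafCount≡2 _ (trans (charge-non-nbr v≢c c≁v) defect≡2)

2≤deg-max : (G : Graph) → (∀ v → ¬ (deg G v ≡ 0)) → (∀ u v → deg G u ≡ 1 → deg G v ≡ 1 → u ≡ v) →
  (c : Fin (order G)) → (∀ v → deg G v ≤ deg G c) → 2 ≤ deg G c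
2≤deg-max G no-isolated one-leaf c c-max with deg G c in deg-c
... | 0           = ⊥-elim (no-isolated c deg-c)
... | suc (suc _) = s≤s (s≤s z≤n)
... | 1           = ⊥-elim (adj⇒≢ G c~w (one-leaf c w deg-c deg-w))
  where
  open Neighbours (neighbours G 1 (≤-reflexive (sym deg-c)))
  w : Fin (order G)
  w = nbr 0F
  c~w : adj G c w ≡ true
  c~w = nbr-adjacent 0F
  deg-w : deg G w ≡ 1
  deg-w with deg G w in deg-w≡ | c-max w
  ... | 0     | _ = ⊥-elim (no-isolated w deg-w≡)
  ... | 1     | _ = refl
  ... | suc (suc _) | s≤s ()

-- Structure of the extremal graphs

module Universal (G : Graph) (c : Fin (order G)) (c-universal : ∀ v → v ≢ c → adj G c v ≡ true) where

  R : Graph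
  R = delete G c

  deg-incl-universal : ∀ a → deg G (incl G c a) ≡ suc (deg R a)
  deg-incl-universal a = trans (deg-incl G c a) (cong (λ b → bit b + deg R a) (c-universal (incl G c a) (incl≢ G c a)))

  deg-universal : ∀ v (v≢c : v ≢ c) → deg G v ≡ suc (deg R (incl⁻¹ G c v v≢c))
  deg-universal v v≢c = trans (cong (deg G) (sym (incl-incl⁻¹ G c v v≢c))) (deg-incl-universal _)

  deg-c≡order : deg G c ≡ order R
  deg-c≡order = trans (deg-via-delete G c) (sum-ones (λ a → cong bit (c-universal (incl G c a) (incl≢ G c a))))

  private
    addVertex-≅ : ∀ {T} → R ≅ T → addVertex R (neighbourhood G c) ≅ addVertex T (λ _ → true)
    addVertex-≅ φ = addVertex-cong φ (neighbourhood G c) (λ _ → true) (λ u → c-universal (incl G c u) (incl≢ G c u))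

  lift : ∀ {T} → R ≅ T → G ≅ (K₁ ∨G T)
  lift {T} φ = peel G c ⨾ addVertex-≅ φ ⨾ addVertex-universal T

  to-lift-c : ∀ {T} (φ : R ≅ T) → to (lift φ) c ≡ zero
  to-lift-c φ = cong (to (addVertex-≅ φ)) (to-peel-self G c)

  to-lift-incl : ∀ {T} (φ : R ≅ T) a → to (lift φ) (incl G c a) ≡ suc (to φ a)
  to-lift-incl φ a = cong (to (addVertex-≅ φ)) (to-peel-incl G c a)

module NonNeighbour (G : Graph) (c w : Fin (order G)) (w≢c : w ≢ c) (c≁w : adj G c w ≡ false)
                    (c-universal : ∀ v → v ≢ c → v ≢ w → adj G c v ≡ true) where

  B : Graph
  B = delete G w

  c′ : Fin (order B)
  c′ = incl⁻¹ G w c (w≢c ∘ sym)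

  incl-c′ : incl G w c′ ≡ c
  incl-c′ = incl-incl⁻¹ G w c (w≢c ∘ sym)

  B-universal : ∀ b → b ≢ c′ → adj B c′ b ≡ true
  B-universal b b≢c′ = trans (adj-delete G w c′ b) (trans (cong (λ v → adj G v (incl G w b)) incl-c′)
    (c-universal (incl G w b) (λ eq → b≢c′ (incl-injective G w (trans eq (sym incl-c′)))) (incl≢ G w b)))

  open Universal B c′ B-universal public

  V : Fin (order R) → Fin (order G)
  V a = incl G w (incl B c′ a)

  V-injective : Injective _≡_ _≡_ V
  V-injective eq = incl-injective B c′ (incl-injective G w eq)

  V≢w : ∀ a → V a ≢ w
  V≢w a = incl≢ G w (incl B c′ a)

  V≢c : ∀ a → V a ≢ c
  V≢c a eq = incl≢ B c′ a (incl-injective G w (trans eq (sym incl-c′)))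

  opaque
    V⁻¹ : ∀ v → v ≢ w → v ≢ c → Fin (order R)
    V⁻¹ v v≢w v≢c = incl⁻¹ B c′ (incl⁻¹ G w v v≢w)
      (λ eq → v≢c (trans (sym (incl-incl⁻¹ G w v v≢w)) (trans (cong (incl G w) eq) incl-c′)))

    V-V⁻¹ : ∀ v v≢w v≢c → V (V⁻¹ v v≢w v≢c) ≡ v
    V-V⁻¹ v v≢w v≢c = trans (cong (incl G w) (incl-incl⁻¹ B c′ _ _)) (incl-incl⁻¹ G w v v≢w)

  V-≢ : ∀ a v v≢w v≢c → a ≢ V⁻¹ v v≢w v≢c → V a ≢ v
  V-≢ a v v≢w v≢c a≢ eq = a≢ (V-injective (trans eq (sym (V-V⁻¹ v v≢w v≢c))))

  deg-V : ∀ a → deg G (V a) ≡ bit (adj G w (V a)) + suc (deg R a)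
  deg-V a = trans (deg-incl G w (incl B c′ a)) (cong (bit (adj G w (V a)) +_) (deg-incl-universal a))

  w≁c : adj G w c ≡ false
  w≁c = trans (adj-sym G w c) c≁w

  deg-c≡order-R : deg G c ≡ order R
  deg-c≡order-R = begin
    deg G c                                 ≡⟨ cong (deg G) incl-c′ ⟨
    deg G (incl G w c′)                     ≡⟨ deg-incl G w c′ ⟩
    bit (adj G w (incl G w c′)) + deg B c′  ≡⟨ cong (λ v → bit (adj G w v) + deg B c′) incl-c′ ⟩
    bit (adj G w c) + deg B c′              ≡⟨ cong (λ b → bit b + deg B c′) w≁c ⟩
    deg B c′                                ≡⟨ deg-c≡order ⟩
    order R                                 ∎
    where open ≡-Reasoning

  deg-R-from : ∀ a {b d} → adj G w (V a) ≡ b → deg G (V a) ≡ bit b + suc d → deg R a ≡ d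
  deg-R-from a {b} w~Va deg-Va = suc-injective (+-cancelˡ-≡ (bit b) _ _
    (trans (cong (λ b′ → bit b′ + suc (deg R a)) (sym w~Va)) (trans (sym (deg-V a)) deg-Va)))

  attach : ∀ {T} (φ : R ≅ T) (s : Fin (suc (order T)) → Bool) → s zero ≡ false →
    (∀ a → adj G w (V a) ≡ s (suc (to φ a))) → G ≅ addVertex (K₁ ∨G T) s
  attach φ s s-centre s-V = peel G w ⨾ addVertex-cong (lift φ) (neighbourhood G w) s compat
    where
    compat : ∀ b → neighbourhood G w b ≡ s (to (lift φ) b)
    compat b with b Fin.≟ c′
    ... | yes refl = trans (cong (adj G w) incl-c′) (trans w≁c (trans (sym s-centre) (cong s (sym (to-lift-c φ)))))
    ... | no  b≢c′ = subst (λ b → neighbourhood G w b ≡ s (to (lift φ) b)) (incl-incl⁻¹ B c′ b b≢c′)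
                       (trans (s-V a) (cong s (sym (to-lift-incl φ a))))
      where
      a : Fin (order R)
      a = incl⁻¹ B c′ b b≢c′

module Extremal (G : Graph) (no-isolated : ∀ v → ¬ (deg G v ≡ 0))
                (one-leaf : ∀ u v → deg G u ≡ 1 → deg G v ≡ 1 → u ≡ v)
                (c : Fin (order G)) (2≤Δ : 2 ≤ deg G c) where
  open Defect G no-isolated one-leaf c public

  leaf≢c : ∀ {u} → deg G u ≡ 1 → u ≢ c
  leaf≢c deg-u refl = <⇒≱ 2≤Δ (≤-reflexive deg-u)

  defect-pos≢c : ∀ {x} → 1 ≤ defect x → x ≢ c
  defect-pos≢c 1≤defect refl = <⇒≱ 1≤defect (≤-reflexive (defect-centre 2≤Δ))

  deg-ordinary : ∀ {v} → v ≢ c → adj G c v ≡ true → defect v ≡ 0 → deg G v ≢ 1 → deg G v ≡ 2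
  deg-ordinary v≢c c~v defect≡0 not-leaf with deg-nbr-defect0 v≢c c~v defect≡0
  ... | inj₁ deg≡1 = ⊥-elim (not-leaf deg≡1)
  ... | inj₂ deg≡2 = deg≡2

  module UniversalCentre (c-universal : ∀ v → v ≢ c → adj G c v ≡ true) where
    open Universal G c c-universal public

    order-R : ∀ {n} → Δ ≡ n → order R ≡ n
    order-R Δ≡n = trans (sym deg-c≡order) Δ≡n

    deg-R : ∀ v (v≢c : v ≢ c) {k} → deg G v ≡ suc k → deg R (incl⁻¹ G c v v≢c) ≡ k
    deg-R v v≢c deg-v = suc-injective (trans (sym (deg-universal v v≢c)) deg-v)

    deg-R-defect1 : ∀ {x} (x≢c : x ≢ c) → defect x ≡ 1 → deg R (incl⁻¹ G c x x≢c) ≡ 2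
    deg-R-defect1 {x} x≢c defect-x = deg-R x x≢c (deg-nbr-defect1 x≢c (c-universal x x≢c) defect-x)

    deg-R-ordinary : ∀ a → defect (incl G c a) ≡ 0 → deg G (incl G c a) ≢ 1 → deg R a ≡ 1
    deg-R-ordinary a defect≡0 not-leaf =
      suc-injective (trans (sym (deg-incl-universal a)) (deg-ordinary (incl≢ G c a) (c-universal _ (incl≢ G c a)) defect≡0 not-leaf))

  universal-if-defect≤1 : (∀ v → defect v ≤ 1) → ∀ v → v ≢ c → adj G c v ≡ true
  universal-if-defect≤1 defect≤1 v v≢c = defect≤1⇒adjacent v≢c (defect≤1 v)

  E₁-structure : ∀ k → Δ ≡ 2 * k → (∀ v → defect v ≡ 0) → (∀ v → deg G v ≢ 1) → G ≅ E₁ k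
  E₁-structure k Δ≡ defect≡0 no-leaf = lift (copies-P₂-of-1-regular k R (order-R Δ≡) (λ a → deg-R-ordinary a (defect≡0 _) (no-leaf _)))
    where open UniversalCentre (universal-if-defect≤1 (λ v → ≡0⇒≤1 (defect≡0 v)))

  defect≤1-except : ∀ {x} → defect x ≡ 1 → (∀ v → v ≢ x → defect v ≡ 0) → ∀ v → defect v ≤ 1
  defect≤1-except {x} defect-x others v with v Fin.≟ x
  ... | yes refl = ≤-reflexive defect-x
  ... | no  v≢x  = ≡0⇒≤1 (others v v≢x)

  defect≤1-except₂ : ∀ {x y} → defect x ≡ 1 → defect y ≡ 1 → (∀ v → v ≢ x → v ≢ y → defect v ≡ 0) → ∀ v → defect v ≤ 1
  defect≤1-except₂ {x} {y} defect-x defect-y others v with v Fin.≟ x | v Fin.≟ y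
  ... | yes refl | _        = ≤-reflexive defect-x
  ... | no  _    | yes refl = ≤-reflexive defect-y
  ... | no  v≢x  | no  v≢y  = ≡0⇒≤1 (others v v≢x v≢y)

  E₂-structure : ∀ k → Δ ≡ 2 * k → ∀ u → deg G u ≡ 1 → ∀ x → defect x ≡ 1 → (∀ v → v ≢ x → defect v ≡ 0) →
    2 ≤ k × G ≅ E₂ k
  E₂-structure k Δ≡ u deg-u x defect-x others =
    Data.Product.map₂ lift (residual-E₂ R k (trans (order-R Δ≡) (sym (+-identityʳ _))) u′ x′ deg-u′ deg-x′ ordinary)
    where
    open UniversalCentre (universal-if-defect≤1 (defect≤1-except defect-x others))
    u≢c : u ≢ c
    u≢c = leaf≢c deg-u
    x≢c : x ≢ c
    x≢c = defect-pos≢c (≤-reflexive (sym defect-x))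
    u′ x′ : Fin (order R)
    u′ = incl⁻¹ G c u u≢c
    x′ = incl⁻¹ G c x x≢c
    deg-u′ : deg R u′ ≡ 0
    deg-u′ = deg-R u u≢c deg-u
    deg-x′ : deg R x′ ≡ 2
    deg-x′ = deg-R-defect1 x≢c defect-x
    ordinary : ∀ a → a ≢ u′ → a ≢ x′ → deg R a ≡ 1
    ordinary a a≢u′ a≢x′ = deg-R-ordinary a (others _ (incl-≢ G c x x≢c a≢x′))
                             (λ deg≡1 → incl-≢ G c u u≢c a≢u′ (one-leaf _ u deg≡1 deg-u))

  F₁-structure : ∀ k → Δ ≡ 2 * k + 1 → ∀ u → deg G u ≡ 1 → (∀ v → defect v ≡ 0) → G ≅ F₁ k
  F₁-structure k Δ≡ u deg-u defect≡0 = lift (proj₁ (residual-F₁ R k (order-R Δ≡) u′ (deg-R u u≢c deg-u) ordinary))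
    where
    open UniversalCentre (universal-if-defect≤1 (λ v → ≡0⇒≤1 (defect≡0 v)))
    u≢c : u ≢ c
    u≢c = leaf≢c deg-u
    u′ : Fin (order R)
    u′ = incl⁻¹ G c u u≢c
    ordinary : ∀ a → a ≢ u′ → deg R a ≡ 1
    ordinary a a≢u′ = deg-R-ordinary a (defect≡0 _) (λ deg≡1 → incl-≢ G c u u≢c a≢u′ (one-leaf _ u deg≡1 deg-u))

  H₃-structure : ∀ k → Δ ≡ 2 * k + 1 → (∀ v → deg G v ≢ 1) → ∀ x → defect x ≡ 1 → (∀ v → v ≢ x → defect v ≡ 0) →
    1 ≤ k × G ≅ H₃ k
  H₃-structure k Δ≡ no-leaf x defect-x others =
    Data.Product.map₂ lift (residual-H₃ R k (order-R Δ≡) x′ (deg-R-defect1 x≢c defect-x) ordinary)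
    where
    open UniversalCentre (universal-if-defect≤1 (defect≤1-except defect-x others))
    x≢c : x ≢ c
    x≢c = defect-pos≢c (≤-reflexive (sym defect-x))
    x′ : Fin (order R)
    x′ = incl⁻¹ G c x x≢c
    ordinary : ∀ a → a ≢ x′ → deg R a ≡ 1
    ordinary a a≢x′ = deg-R-ordinary a (others _ (incl-≢ G c x x≢c a≢x′)) (no-leaf _)

  H₄-structure : ∀ k → Δ ≡ 2 * k + 1 → ∀ u → deg G u ≡ 1 → ∀ x → defect x ≡ 2 → adj G c x ≡ true →
    (∀ v → v ≢ x → defect v ≡ 0) → 2 ≤ k × G ≅ H₄ k
  H₄-structure k Δ≡ u deg-u x defect-x c~x others =
    Data.Product.map₂ lift (residual-H₄ R k (order-R Δ≡) u′ x′ (deg-R u u≢c deg-u) deg-x′ ordinary)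
    where
    c-universal : ∀ v → v ≢ c → adj G c v ≡ true
    c-universal v v≢c with v Fin.≟ x
    ... | yes refl = c~x
    ... | no  v≢x  = defect≤1⇒adjacent v≢c (≡0⇒≤1 (others v v≢x))
    open UniversalCentre c-universal
    u≢c : u ≢ c
    u≢c = leaf≢c deg-u
    x≢c : x ≢ c
    x≢c = defect-pos≢c (≤-trans (s≤s z≤n) (≤-reflexive (sym defect-x)))
    u′ x′ : Fin (order R)
    u′ = incl⁻¹ G c u u≢c
    x′ = incl⁻¹ G c x x≢c
    deg-x′ : deg R x′ ≡ 3
    deg-x′ = deg-R x x≢c (deg-nbr-defect2 x≢c c~x defect-x)
    ordinary : ∀ a → a ≢ u′ → a ≢ x′ → deg R a ≡ 1
    ordinary a a≢u′ a≢x′ = deg-R-ordinary a (others _ (incl-≢ G c x x≢c a≢x′))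
                             (λ deg≡1 → incl-≢ G c u u≢c a≢u′ (one-leaf _ u deg≡1 deg-u))

  module H₅₆ (k : ℕ) (Δ≡ : Δ ≡ 2 * k + 1) (u : Fin (order G)) (deg-u : deg G u ≡ 1) (x y : Fin (order G)) (x≢y : x ≢ y)
             (defect-x : defect x ≡ 1) (defect-y : defect y ≡ 1) (others : ∀ v → v ≢ x → v ≢ y → defect v ≡ 0) where
    open UniversalCentre (universal-if-defect≤1 (defect≤1-except₂ defect-x defect-y others))
    u≢c : u ≢ c
    u≢c = leaf≢c deg-u
    x≢c : x ≢ c
    x≢c = defect-pos≢c (≤-reflexive (sym defect-x))
    y≢c : y ≢ c
    y≢c = defect-pos≢c (≤-reflexive (sym defect-y))
    u′ x′ y′ : Fin (order R)
    u′ = incl⁻¹ G c u u≢c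
    x′ = incl⁻¹ G c x x≢c
    y′ = incl⁻¹ G c y y≢c
    x′≢y′ : x′ ≢ y′
    x′≢y′ eq = x≢y (trans (sym (incl-incl⁻¹ G c x x≢c)) (trans (cong (incl G c) eq) (incl-incl⁻¹ G c y y≢c)))
    ordinary : ∀ a → a ≢ u′ → a ≢ x′ → a ≢ y′ → deg R a ≡ 1
    ordinary a a≢u′ a≢x′ a≢y′ = deg-R-ordinary a (others _ (incl-≢ G c x x≢c a≢x′) (incl-≢ G c y y≢c a≢y′))
                                  (λ deg≡1 → incl-≢ G c u u≢c a≢u′ (one-leaf _ u deg≡1 deg-u))

    structure : (2 ≤ k × G ≅ H₅ k) ⊎ (3 ≤ k × G ≅ H₆ k)
    structure with adj R x′ y′ in x′~y′
    ... | true  = inj₁ (Data.Product.map₂ lift (residual-H₅ R k (order-R Δ≡) u′ x′ y′ (deg-R u u≢c deg-u)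
                         (deg-R-defect1 x≢c defect-x) (deg-R-defect1 y≢c defect-y) x′~y′ ordinary))
    ... | false = inj₂ (Data.Product.map₂ lift (residual-H₆ R k (order-R Δ≡) u′ x′ y′ (deg-R u u≢c deg-u)
                         (deg-R-defect1 x≢c defect-x) (deg-R-defect1 y≢c defect-y) x′≢y′ x′~y′ ordinary))

  L₂-structure : ∀ k → Δ ≡ 2 * k + 1 → ∀ w → w ≢ c → adj G c w ≡ false → deg G w ≡ 1 → (∀ v → v ≢ w → defect v ≡ 0) →
    G ≅ L₂ k
  L₂-structure k Δ≡ w w≢c c≁w deg-w others = attach φ (λ v → suc (2 * k) ≡ᵇ toℕ v) refl w~V
    where
    c-universal : ∀ v → v ≢ c → v ≢ w → adj G c v ≡ true
    c-universal v v≢c v≢w = defect≤1⇒adjacent v≢c (≡0⇒≤1 (others v v≢w))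
    open NonNeighbour G c w w≢c c≁w c-universal
    open Neighbours (neighbours G 1 (≤-reflexive (sym deg-w))) using (nbr; nbr-adjacent)
    p : Fin (order G)
    p = nbr 0F
    w~p : adj G w p ≡ true
    w~p = nbr-adjacent 0F
    p≢w : p ≢ w
    p≢w = adj⇒≢ G w~p ∘ sym
    p≢c : p ≢ c
    p≢c eq with trans (sym w~p) (trans (cong (adj G w) eq) w≁c)
    ... | ()
    p′ : Fin (order R)
    p′ = V⁻¹ p p≢w p≢c
    not-leaf : ∀ {v} → v ≢ w → deg G v ≢ 1
    not-leaf v≢w deg≡1 = v≢w (one-leaf _ w deg≡1 deg-w)
    deg-p′ : deg R p′ ≡ 0
    deg-p′ = deg-R-from p′ (trans (cong (adj G w) (V-V⁻¹ p p≢w p≢c)) w~p)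
               (trans (cong (deg G) (V-V⁻¹ p p≢w p≢c)) (deg-ordinary p≢c (c-universal p p≢c p≢w) (others p p≢w) (not-leaf p≢w)))
    w≁V : ∀ a → a ≢ p′ → adj G w (V a) ≡ false
    w≁V a a≢p′ = Bool.¬-not (λ w~Va → V-≢ a p p≢w p≢c a≢p′ (leaf-neighbour G deg-w w~p w~Va))
    ordinary : ∀ a → a ≢ p′ → deg R a ≡ 1
    ordinary a a≢p′ = deg-R-from a (w≁V a a≢p′)
      (deg-ordinary (V≢c a) (c-universal _ (V≢c a) (V≢w a)) (others _ (V≢w a)) (not-leaf (V≢w a)))
    residual : Σ (R ≅ (copies k P₂ ∪ K₁)) λ φ → to φ p′ ≡ order (copies k P₂) ↑ʳ zero
    residual = residual-F₁ R k (trans (sym deg-c≡order-R) Δ≡) p′ deg-p′ ordinary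
    φ : R ≅ (copies k P₂ ∪ K₁)
    φ = proj₁ residual
    position-p′ : toℕ (to φ p′) ≡ 2 * k
    position-p′ = trans (cong toℕ (proj₂ residual))
                    (trans (Fin.toℕ-↑ʳ (order (copies k P₂)) zero) (trans (+-identityʳ _) (order-copies-P₂ k)))
    w~V : ∀ a → adj G w (V a) ≡ (2 * k ≡ᵇ toℕ (to φ a))
    w~V a = by-cases a (a Fin.≟ p′)
      where
      by-cases : ∀ a → Dec (a ≡ p′) → adj G w (V a) ≡ (2 * k ≡ᵇ toℕ (to φ a))
      by-cases a (yes refl) = trans (cong (adj G w) (V-V⁻¹ p p≢w p≢c)) (trans w~p (sym (≡⇒≡ᵇ≡true (sym position-p′))))
      by-cases a (no  a≢p′) = trans (w≁V a a≢p′) (sym (≢⇒≡ᵇ≡false (λ eq → a≢p′ (to-injective φ (Fin.toℕ-injective (trans (sym eq) (sym position-p′)))))))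

  L₁-structure : ∀ k → Δ ≡ 2 * k + 1 → ∀ u → deg G u ≡ 1 → ∀ w → w ≢ c → adj G c w ≡ false → deg G w ≡ 2 →
    (∀ v → v ≢ w → defect v ≡ 0) → 1 ≤ k × G ≅ L₁ k
  L₁-structure k Δ≡ u deg-u w w≢c c≁w deg-w others = 1≤k , attach φ (λ v → 2 * k ≤ᵇ toℕ v) s-centre w~V
    where
    c-universal : ∀ v → v ≢ c → v ≢ w → adj G c v ≡ true
    c-universal v v≢c v≢w = defect≤1⇒adjacent v≢c (≡0⇒≤1 (others v v≢w))
    open NonNeighbour G c w w≢c c≁w c-universal
    N : Neighbours G w 2
    N = neighbours G 2 (≤-reflexive (sym deg-w))
    open Neighbours N using (nbr; nbr-adjacent; nbr-injective)
    w-nbr≢w : ∀ i → nbr i ≢ w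
    w-nbr≢w i = adj⇒≢ G (nbr-adjacent i) ∘ sym
    w-nbr≢c : ∀ i → nbr i ≢ c
    w-nbr≢c i eq with trans (sym (nbr-adjacent i)) (trans (cong (adj G w) eq) w≁c)
    ... | ()
    w≁c-nbr : ∀ {v} → v ≢ c → adj G c v ≡ true → deg G v ≡ 1 → adj G w v ≡ false
    w≁c-nbr v≢c c~v deg-v = Bool.¬-not λ w~v → w≢c (leaf-neighbour G deg-v (adj-symᵗ G c~v) (adj-symᵗ G w~v))
    deg-w-nbr : ∀ i → deg G (nbr i) ≡ 2
    deg-w-nbr i = deg-ordinary (w-nbr≢c i) (c-universal _ (w-nbr≢c i) (w-nbr≢w i)) (others _ (w-nbr≢w i))
      (λ deg≡1 → case trans (sym (nbr-adjacent i)) (w≁c-nbr (w-nbr≢c i) (c-universal _ (w-nbr≢c i) (w-nbr≢w i)) deg≡1) of λ ())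
    u≢w : u ≢ w
    u≢w = deg≢⇒≢ G deg-u deg-w (λ ())
    u≢c : u ≢ c
    u≢c = leaf≢c deg-u
    y′ z′ u′ : Fin (order R)
    y′ = V⁻¹ (nbr 0F) (w-nbr≢w 0F) (w-nbr≢c 0F)
    z′ = V⁻¹ (nbr 1F) (w-nbr≢w 1F) (w-nbr≢c 1F)
    u′ = V⁻¹ u u≢w u≢c
    deg-w-nbr′ : ∀ i → deg R (V⁻¹ (nbr i) (w-nbr≢w i) (w-nbr≢c i)) ≡ 0
    deg-w-nbr′ i = deg-R-from _ (trans (cong (adj G w) (V-V⁻¹ _ _ _)) (nbr-adjacent i)) (trans (cong (deg G) (V-V⁻¹ _ _ _)) (deg-w-nbr i))
    deg-u′ : deg R u′ ≡ 0
    deg-u′ = deg-R-from u′ (trans (cong (adj G w) (V-V⁻¹ u u≢w u≢c)) (w≁c-nbr u≢c (c-universal u u≢c u≢w) deg-u))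
                           (trans (cong (deg G) (V-V⁻¹ u u≢w u≢c)) deg-u)
    V⁻¹-≢ : ∀ {v v′} {v≢w v≢c v′≢w v′≢c} → v ≢ v′ → V⁻¹ v v≢w v≢c ≢ V⁻¹ v′ v′≢w v′≢c
    V⁻¹-≢ v≢v′ eq = v≢v′ (trans (sym (V-V⁻¹ _ _ _)) (trans (cong V eq) (V-V⁻¹ _ _ _)))
    u≢w-nbr : ∀ i → u ≢ nbr i
    u≢w-nbr i = deg≢⇒≢ G deg-u (deg-w-nbr i) (λ ())
    w≁V : ∀ a → a ≢ y′ → a ≢ z′ → adj G w (V a) ≡ false
    w≁V a a≢y′ a≢z′ = Bool.¬-not λ w~Va → case neighbour-listed G deg-w N w~Va of λ
      { (0F , eq) → V-≢ a _ _ _ a≢y′ eq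
      ; (1F , eq) → V-≢ a _ _ _ a≢z′ eq }
    ordinary : ∀ a → a ≢ u′ → a ≢ y′ → a ≢ z′ → deg R a ≡ 1
    ordinary a a≢u′ a≢y′ a≢z′ = deg-R-from a (w≁V a a≢y′ a≢z′)
      (deg-ordinary (V≢c a) (c-universal _ (V≢c a) (V≢w a)) (others _ (V≢w a)) (λ deg≡1 → V-≢ a u u≢w u≢c a≢u′ (one-leaf _ u deg≡1 deg-u)))
    residual : 1 ≤ k × Σ (R ≅ (copies (k ∸ 1) P₂ ∪ empty 3)) λ φ →
      to φ y′ ≡ order (copies (k ∸ 1) P₂) ↑ʳ 1F × to φ z′ ≡ order (copies (k ∸ 1) P₂) ↑ʳ 2F
    residual = residual-L₁ R k (trans (sym deg-c≡order-R) Δ≡) u′ y′ z′ deg-u′ (deg-w-nbr′ 0F) (deg-w-nbr′ 1F)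
                 (V⁻¹-≢ (u≢w-nbr 0F)) (V⁻¹-≢ (u≢w-nbr 1F)) (V⁻¹-≢ (λ eq → case nbr-injective eq of λ ())) ordinary
    1≤k : 1 ≤ k
    1≤k = proj₁ residual
    φ : R ≅ (copies (k ∸ 1) P₂ ∪ empty 3)
    φ = proj₁ (proj₂ residual)
    s-centre : (2 * k ≤ᵇ 0) ≡ false
    s-centre = ≰⇒≤ᵇ≡false (<⇒≱ (≤-trans (s≤s z≤n) (*-monoʳ-≤ 2 1≤k)))
    K : ℕ
    K = 2 * (k ∸ 1)
    2k≡2+K : 2 * k ≡ 2 + K
    2k≡2+K = trans (cong (2 *_) (sym (m+[n∸m]≡n 1≤k))) (*-distribˡ-+ 2 1 (k ∸ 1))
    position : ∀ {a} i → to φ a ≡ order (copies (k ∸ 1) P₂) ↑ʳ i → toℕ (to φ a) ≡ toℕ i + K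
    position {a} i eq = trans (cong toℕ eq) (trans (Fin.toℕ-↑ʳ (order (copies (k ∸ 1) P₂)) i)
                          (trans (+-comm _ (toℕ i)) (cong (toℕ i +_) (order-copies-P₂ (k ∸ 1)))))
    w~V : ∀ a → adj G w (V a) ≡ (2 * k ≤ᵇ suc (toℕ (to φ a)))
    w~V a = by-cases a (a Fin.≟ y′) (a Fin.≟ z′)
      where
      by-cases : ∀ a → Dec (a ≡ y′) → Dec (a ≡ z′) → adj G w (V a) ≡ (2 * k ≤ᵇ suc (toℕ (to φ a)))
      by-cases a (yes refl) _ = trans (trans (cong (adj G w) (V-V⁻¹ (nbr 0F) (w-nbr≢w 0F) (w-nbr≢c 0F))) (nbr-adjacent 0F))
                                  (sym (≤⇒≤ᵇ≡true (≤-reflexive (trans 2k≡2+K (cong suc (sym (position 1F (proj₁ (proj₂ (proj₂ residual))))))))))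
      by-cases a (no _) (yes refl) = trans (trans (cong (adj G w) (V-V⁻¹ (nbr 1F) (w-nbr≢w 1F) (w-nbr≢c 1F))) (nbr-adjacent 1F))
                                  (sym (≤⇒≤ᵇ≡true (≤-trans (≤-reflexive 2k≡2+K)
                                    (≤-trans (n≤1+n _) (≤-reflexive (cong suc (sym (position 2F (proj₂ (proj₂ (proj₂ residual)))))))))))
      by-cases a (no a≢y′) (no a≢z′) = trans (w≁V a a≢y′ a≢z′) (sym (≰⇒≤ᵇ≡false (λ 2k≤ → <⇒≱ (s≤s (s≤s before-leaves)) (≤-trans (≤-reflexive (sym 2k≡2+K)) 2k≤))))
        where
        t : ℕ
        t = toℕ (to φ a)
        t≢ : ∀ {b} → b ≢ a → ∀ i → to φ b ≡ order (copies (k ∸ 1) P₂) ↑ʳ i → t ≢ toℕ i + K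
        t≢ b≢a i eq t≡ = b≢a (to-injective φ (Fin.toℕ-injective (trans (position i eq) (sym t≡))))
        before-leaves : t ≤ K
        before-leaves = ≤-pred (≤∧≢⇒< (≤-pred (≤∧≢⇒< (≤-pred (subst (t <_) (trans (+-comm _ 3) (cong (3 +_) (order-copies-P₂ (k ∸ 1)))) (Fin.toℕ<n (to φ a))))
                          (t≢ (a≢z′ ∘ sym) 2F (proj₂ (proj₂ (proj₂ residual)))))) (t≢ (a≢y′ ∘ sym) 1F (proj₁ (proj₂ (proj₂ residual)))))

3k-case : ∀ k ℓ D → 2 * (3 * k) + ℓ ≡ 3 * (2 * k) + D → ℓ ≡ D
3k-case k ℓ D eq = +-cancelˡ-≡ (3 * (2 * k)) ℓ D (trans (cong (_+ ℓ) (sym (regroup k))) eq)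
  where
  regroup : ∀ k → 2 * (3 * k) ≡ 3 * (2 * k)
  regroup = solve-∀

3k+1-case : ∀ k ℓ D → 2 * (3 * k + 1) + ℓ ≡ 3 * (2 * k + 1) + D → ℓ ≡ suc D
3k+1-case k ℓ D eq = +-cancelˡ-≡ (6 * k + 2) ℓ (suc D) (trans (cong (_+ ℓ) (sym (regroup₁ k))) (trans eq (regroup₂ k D)))
  where
  regroup₁ : ∀ k → 2 * (3 * k + 1) ≡ 6 * k + 2
  regroup₁ = solve-∀
  regroup₂ : ∀ k D → 3 * (2 * k + 1) + D ≡ 6 * k + 2 + suc D
  regroup₂ = solve-∀

3k+2-case : ∀ k ℓ D → 2 * (3 * k + 2) + ℓ ≡ 3 * (2 * k + 1) + D → D ≡ suc ℓ
3k+2-case k ℓ D eq = sym (+-cancelˡ-≡ (6 * k + 3) (suc ℓ) D (trans (regroup₁ k ℓ) (trans eq (cong (_+ D) (regroup₂ k)))))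
  where
  regroup₁ : ∀ k ℓ → 6 * k + 3 + suc ℓ ≡ 2 * (3 * k + 2) + ℓ
  regroup₁ = solve-∀
  regroup₂ : ∀ k → 3 * (2 * k + 1) ≡ 6 * k + 3
  regroup₂ = solve-∀

2*[k∸r]+[2r+t] : ∀ k r t → r ≤ k → 2 * (k ∸ r) + (2 * r + t) ≡ 2 * k + t
2*[k∸r]+[2r+t] k r t r≤k = trans (regroup (k ∸ r) r t) (cong (λ n → 2 * n + t) (m+[n∸m]≡n r≤k))
  where
  regroup : ∀ d r t → 2 * d + (2 * r + t) ≡ 2 * (r + d) + t
  regroup = solve-∀

≤1⇒0⊎1 : ∀ {n} → n ≤ 1 → n ≡ 0 ⊎ n ≡ 1
≤1⇒0⊎1 z≤n       = inj₁ refl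
≤1⇒0⊎1 (s≤s z≤n) = inj₂ refl

≅⇒deg≤maxDeg : ∀ {G H} → G ≅ H → ∀ t → deg H t ≤ maxDeg G
≅⇒deg≤maxDeg {G} φ t = ≤-trans (≤-reflexive (sym (deg-from φ t))) (deg≤maxDeg G _)

deg-cone : ∀ T → deg (K₁ ∨G T) zero ≡ order T
deg-cone T = deg-combine-ˡ K₁ T true zero

order≤deg-cone-addVertex : ∀ T (s : Fin (order (K₁ ∨G T)) → Bool) → order T ≤ deg (addVertex (K₁ ∨G T) s) (suc zero)
order≤deg-cone-addVertex T s = ≤-trans (≤-reflexive (sym (deg-cone T)))
  (≤-trans (m≤n+m _ (bit (s zero))) (≤-reflexive (sym (deg-addVertex-suc (K₁ ∨G T) s zero))))

module MainTheorem (G : Graph) (1≤order : 1 ≤ order G) (no-isolated : ∀ v → ¬ (deg G v ≡ 0))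
                   (one-leaf : ∀ u v → deg G u ≡ 1 → deg G v ≡ 1 → u ≡ v) where

  c : Fin (order G)
  c = proj₁ (maxDeg-attained G 1≤order)

  deg-c : deg G c ≡ maxDeg G
  deg-c = proj₂ (maxDeg-attained G 1≤order)

  c-max : ∀ v → deg G v ≤ deg G c
  c-max v = subst (deg G v ≤_) (sym deg-c) (deg≤maxDeg G v)

  open Extremal G no-isolated one-leaf c (2≤deg-max G no-isolated one-leaf c c-max)

  bound : ℕ
  bound = (2 * edges G + 1) / 3

  upper-bound : maxDeg G ≤ bound
  upper-bound = subst (_≤ bound) deg-c (3*≤⇒≤/3 Δ _ 3Δ≤2m+1)

  attains : ∀ {n} → bound ≡ n → n ≤ maxDeg G → maxDeg G ≡ bound
  attains bound≡n n≤max = trans (≤-antisym (subst (maxDeg G ≤_) bound≡n upper-bound) n≤max) (sym bound≡n)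

  cone-attains : ∀ {T n} → G ≅ (K₁ ∨G T) → order T ≡ n → n ≤ maxDeg G
  cone-attains φ order≡n = ≤-trans (≤-reflexive (trans (sym order≡n) (sym (deg-cone _)))) (≅⇒deg≤maxDeg φ zero)

  addVertex-cone-attains : ∀ {T s n} → G ≅ addVertex (K₁ ∨G T) s → order T ≡ n → n ≤ maxDeg G
  addVertex-cone-attains {T} {s} φ order≡n =
    ≤-trans (≤-reflexive (sym order≡n)) (≤-trans (order≤deg-cone-addVertex T s) (≅⇒deg≤maxDeg φ (suc zero)))

  counting : ∀ {m n} → edges G ≡ m → Δ ≡ n → 2 * m + ℓ ≡ 3 * n + sum defect
  counting refl refl = 2m+ℓ≡3Δ+defect

  no-leaf : ℓ ≡ 0 → ∀ v → deg G v ≢ 1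
  no-leaf ℓ≡0 v deg≡1 with trans (sym (cong leafCount deg≡1)) (sum-zero-inv (leafCount ∘ deg G) ℓ≡0 v)
  ... | ()

  the-leaf : ℓ ≡ 1 → ∃ λ u → deg G u ≡ 1
  the-leaf ℓ≡1 = Data.Product.map₂ (leafCount≡1⇒≡1 _ ∘ proj₁) (sum≡1-inv (leafCount ∘ deg G) ℓ≡1)

  case-3k : ∀ k → edges G ≡ 3 * k → (maxDeg G ≡ bound ⇔ (G ≅ E₁ k ⊎ (2 ≤ k × G ≅ E₂ k)))
  case-3k k m≡ = mk⇔ extremal attained
    where
    bound≡ : bound ≡ 2 * k
    bound≡ = trans (cong (λ m → (2 * m + 1) / 3) m≡) (⌊2m+1/3⌋-3k k)
    extremal : maxDeg G ≡ bound → G ≅ E₁ k ⊎ (2 ≤ k × G ≅ E₂ k)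
    extremal max≡ = by-leaves (≤1⇒0⊎1 ℓ≤1)
      where
      Δ≡ : Δ ≡ 2 * k
      Δ≡ = trans deg-c (trans max≡ bound≡)
      ℓ≡D : ℓ ≡ sum defect
      ℓ≡D = 3k-case k ℓ (sum defect) (counting m≡ Δ≡)
      by-leaves : ℓ ≡ 0 ⊎ ℓ ≡ 1 → G ≅ E₁ k ⊎ (2 ≤ k × G ≅ E₂ k)
      by-leaves (inj₁ ℓ≡0) = inj₁ (E₁-structure k Δ≡ (sum-zero-inv defect (trans (sym ℓ≡D) ℓ≡0)) (no-leaf ℓ≡0))
      by-leaves (inj₂ ℓ≡1)
        with u , deg-u ← the-leaf ℓ≡1
        with x , defect-x , others ← sum≡1-inv defect (trans (sym ℓ≡D) ℓ≡1)
        = inj₂ (E₂-structure k Δ≡ u deg-u x defect-x others)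
    attained : G ≅ E₁ k ⊎ (2 ≤ k × G ≅ E₂ k) → maxDeg G ≡ bound
    attained (inj₁ φ)         = attains bound≡ (cone-attains φ (order-copies-P₂ k))
    attained (inj₂ (2≤k , φ)) = attains bound≡ (cone-attains φ
      (trans (cong (_+ 4) (order-copies-P₂ (k ∸ 2))) (trans (2*[k∸r]+[2r+t] k 2 0 2≤k) (+-identityʳ _))))

  case-3k+1 : ∀ k → edges G ≡ 3 * k + 1 → (maxDeg G ≡ bound ⇔ G ≅ F₁ k)
  case-3k+1 k m≡ = mk⇔ extremal attained
    where
    bound≡ : bound ≡ 2 * k + 1
    bound≡ = trans (cong (λ m → (2 * m + 1) / 3) m≡) (⌊2m+1/3⌋-3k+1 k)
    extremal : maxDeg G ≡ bound → G ≅ F₁ k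
    extremal max≡ = from-leaf (the-leaf (trans ℓ≡1+D (cong suc D≡0)))
      where
      Δ≡ : Δ ≡ 2 * k + 1
      Δ≡ = trans deg-c (trans max≡ bound≡)
      ℓ≡1+D : ℓ ≡ suc (sum defect)
      ℓ≡1+D = 3k+1-case k ℓ (sum defect) (counting m≡ Δ≡)
      D≡0 : sum defect ≡ 0
      D≡0 = n≤0⇒n≡0 (≤-pred (≤-trans (≤-reflexive (sym ℓ≡1+D)) ℓ≤1))
      from-leaf : (∃ λ u → deg G u ≡ 1) → G ≅ F₁ k
      from-leaf (u , deg-u) = F₁-structure k Δ≡ u deg-u (sum-zero-inv defect D≡0)
    attained : G ≅ F₁ k → maxDeg G ≡ bound
    attained φ = attains bound≡ (cone-attains φ (cong (_+ 1) (order-copies-P₂ k)))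

  Classification-3k+2 : ℕ → Set
  Classification-3k+2 k = (1 ≤ k × G ≅ L₁ k) ⊎ G ≅ L₂ k ⊎ (1 ≤ k × G ≅ H₃ k)
                          ⊎ (2 ≤ k × G ≅ H₄ k) ⊎ (2 ≤ k × G ≅ H₅ k) ⊎ (3 ≤ k × G ≅ H₆ k)

  module _ (k : ℕ) (Δ≡ : Δ ≡ 2 * k + 1) where

    single-defect-2 : ∀ u → deg G u ≡ 1 → ∀ x → defect x ≡ 2 → (∀ v → v ≢ x → defect v ≡ 0) → Classification-3k+2 k
    single-defect-2 u deg-u x defect-x others = by-adjacency (adj G c x) refl
      where
      x≢c : x ≢ c
      x≢c = defect-pos≢c (≤-trans (s≤s z≤n) (≤-reflexive (sym defect-x)))
      by-degree : adj G c x ≡ false → deg G x ≡ 1 ⊎ deg G x ≡ 2 → Classification-3k+2 k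
      by-degree c≁x (inj₁ deg≡1) = inj₂ (inj₁ (L₂-structure k Δ≡ x x≢c c≁x deg≡1 others))
      by-degree c≁x (inj₂ deg≡2) = inj₁ (L₁-structure k Δ≡ u deg-u x x≢c c≁x deg≡2 others)
      by-adjacency : ∀ b → adj G c x ≡ b → Classification-3k+2 k
      by-adjacency true  c~x = inj₂ (inj₂ (inj₂ (inj₁ (H₄-structure k Δ≡ u deg-u x defect-x c~x others))))
      by-adjacency false c≁x = by-degree c≁x (deg-non-nbr-defect2 x≢c c≁x defect-x)

    by-defects : ℓ ≡ 0 ⊎ ℓ ≡ 1 → sum defect ≡ suc ℓ → Classification-3k+2 k
    by-defects (inj₁ ℓ≡0) D≡1+ℓ with x , defect-x , others ← sum≡1-inv defect (trans D≡1+ℓ (cong suc ℓ≡0))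
      = inj₂ (inj₂ (inj₁ (H₃-structure k Δ≡ (no-leaf ℓ≡0) x defect-x others)))
    by-defects (inj₂ ℓ≡1) D≡1+ℓ with u , deg-u ← the-leaf ℓ≡1 | sum≡2-inv defect (trans D≡1+ℓ (cong suc ℓ≡1))
    ... | inj₁ (x , defect-x , others) = single-defect-2 u deg-u x defect-x others
    ... | inj₂ (x , y , x≢y , defect-x , defect-y , others) with H₅₆.structure k Δ≡ u deg-u x y x≢y defect-x defect-y others
    ...   | inj₁ H₅ = inj₂ (inj₂ (inj₂ (inj₂ (inj₁ H₅))))
    ...   | inj₂ H₆ = inj₂ (inj₂ (inj₂ (inj₂ (inj₂ H₆))))

  case-3k+2 : ∀ k → edges G ≡ 3 * k + 2 → (maxDeg G ≡ bound ⇔ Classification-3k+2 k)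
  case-3k+2 k m≡ = mk⇔ extremal attained
    where
    bound≡ : bound ≡ 2 * k + 1
    bound≡ = trans (cong (λ m → (2 * m + 1) / 3) m≡) (⌊2m+1/3⌋-3k+2 k)
    extremal : maxDeg G ≡ bound → Classification-3k+2 k
    extremal max≡ = by-defects k Δ≡ (≤1⇒0⊎1 ℓ≤1) (3k+2-case k ℓ (sum defect) (counting m≡ Δ≡))
      where
      Δ≡ : Δ ≡ 2 * k + 1
      Δ≡ = trans deg-c (trans max≡ bound≡)
    order≡ : ∀ r t → r ≤ k → 2 * (k ∸ r) + (2 * r + t) ≡ 2 * k + t
    order≡ r t = 2*[k∸r]+[2r+t] k r t
    attained : Classification-3k+2 k → maxDeg G ≡ bound
    attained (inj₁ (1≤k , φ))                              = attains bound≡ (addVertex-cone-attains φ (trans (cong (_+ 3) (order-copies-P₂ (k ∸ 1))) (order≡ 1 1 1≤k)))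
    attained (inj₂ (inj₁ φ))                               = attains bound≡ (addVertex-cone-attains φ (cong (_+ 1) (order-copies-P₂ k)))
    attained (inj₂ (inj₂ (inj₁ (1≤k , φ))))                = attains bound≡ (cone-attains φ (trans (cong (_+ 3) (order-copies-P₂ (k ∸ 1))) (order≡ 1 1 1≤k)))
    attained (inj₂ (inj₂ (inj₂ (inj₁ (2≤k , φ)))))         = attains bound≡ (cone-attains φ (trans (cong (_+ 5) (order-copies-P₂ (k ∸ 2))) (order≡ 2 1 2≤k)))
    attained (inj₂ (inj₂ (inj₂ (inj₂ (inj₁ (2≤k , φ)))))) = attains bound≡ (cone-attains φ (trans (cong (_+ 5) (order-copies-P₂ (k ∸ 2))) (order≡ 2 1 2≤k)))
    attained (inj₂ (inj₂ (inj₂ (inj₂ (inj₂ (3≤k , φ)))))) = attains bound≡ (cone-attains φ (trans (cong (_+ 7) (order-copies-P₂ (k ∸ 3))) (order≡ 3 1 3≤k)))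

lemma3p3 : (G : Graph) → 1 ≤ order G
         → (∀ v → ¬ (deg G v ≡ 0))
         → (∀ u v → deg G u ≡ 1 → deg G v ≡ 1 → u ≡ v)
         → (maxDeg G ≤ (2 * edges G + 1) / 3)
           × (∀ k → edges G ≡ 3 * k
                → (maxDeg G ≡ (2 * edges G + 1) / 3
                   ⇔ (G ≅ E₁ k ⊎ (2 ≤ k × G ≅ E₂ k))))
           × (∀ k → edges G ≡ 3 * k + 1
                → (maxDeg G ≡ (2 * edges G + 1) / 3 ⇔ G ≅ F₁ k))
           × (∀ k → edges G ≡ 3 * k + 2
                → (maxDeg G ≡ (2 * edges G + 1) / 3
                   ⇔ ((1 ≤ k × G ≅ L₁ k) ⊎ G ≅ L₂ k ⊎ (1 ≤ k × G ≅ H₃ k)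
                      ⊎ (2 ≤ k × G ≅ H₄ k) ⊎ (2 ≤ k × G ≅ H₅ k) ⊎ (3 ≤ k × G ≅ H₆ k))))
lemma3p3 G 1≤order no-isolated one-leaf = upper-bound , case-3k , case-3k+1 , case-3k+2
  where open MainTheorem G 1≤order no-isolated one-leaf
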